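{- Let $T$ be a tree on $n$ vertices and $b$ a nonnegative integer. The number of vertices of $T$ of degree $b$ equals \[\sum_{\lambda\vdash n} c_\lambda(T)\,(-1)^{n-b-1}\, m_1(\lambda)\binom{n-\ell(\lambda)}{n-b-1}.\]
   Context: The chromatic symmetric function of $T=(V,E)$ is $X_T=\sum_{\kappa}\prod_{v\in V}x_{\kappa(v)}$, the sum over all maps $\kappa:V\to\mathbb{Z}_{>0}$ with $\kappa(u)\ne\kappa(v)$ for every edge $uv$. The numbers $c_\lambda(T)$ are its coefficients in the power-sum basis: $X_T=\sum_{\lambda\vdash n}c_\lambda(T)p_\lambda$, where $p_\lambda=\prod_i\big(\sum_{j\ge1}x_j^{\lambda_i}\big)$. For a partition $\lambda$, $\ell(\lambda)$ is its number of parts and $m_1(\lambda)$ is the number of parts equal to $1$. Binomial coefficients $\binom{p}{q}$ are $0$ when $q<0$ or $q>p$. -}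

module Defs where

open import Data.Bool using (Bool; true; false; if_then_else_; _∧_; not)
open import Data.Nat as ℕ using (ℕ; zero; suc; _∸_; _<ᵇ_; _≡ᵇ_; _⊓_)
open import Data.Nat.Combinatorics using (_C_)
open import Data.Integer as ℤ using (ℤ; +_; -1ℤ; 0ℤ; 1ℤ)
open import Data.Fin as Fin using (Fin; zero; suc)
open import Data.Fin.Properties using (_≟_)
open import Data.List using (List; []; _∷_; map; concatMap; length; filter; applyUpTo; allFin; foldr; last)
open import Data.List.Relation.Unary.Unique.Propositional using (Unique)
open import Data.Product using (Σ; _×_; _,_)
open import Relation.Nullary.Decidable using (⌊_⌋)
open import Relation.Binary.PropositionalEquality using (_≡_)
open import Data.Empty using (⊥)

Σℤ : {A : Set} → List A → (A → ℤ) → ℤ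
Σℤ xs f = foldr (λ a s → f a ℤ.+ s) 0ℤ xs

Πℤ : {A : Set} → List A → (A → ℤ) → ℤ
Πℤ xs f = foldr (λ a s → f a ℤ.* s) 1ℤ xs

count : {A : Set} → List A → (A → Bool) → ℕ
count xs p = length (filter (λ a → Data.Bool._≟_ (p a) true) xs)
  where import Data.Bool

consF : ∀ {n k} → Fin k → (Fin n → Fin k) → (Fin (suc n) → Fin k)
consF i g zero    = i
consF i g (suc j) = g j

allFuns : (n k : ℕ) → List (Fin n → Fin k)
allFuns zero    k = (λ ()) ∷ []
allFuns (suc n) k = concatMap (λ i → map (consF i) (allFuns n k)) (allFin k)

record Graph (n : ℕ) : Set where
  field
    adj    : Fin n → Fin n → Bool
    symm   : ∀ u v → adj u v ≡ adj v u
    irrefl : ∀ v → adj v v ≡ false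
open Graph public

data Reach {n : ℕ} (G : Graph n) : Fin n → Fin n → Set where
  here : ∀ {v} → Reach G v v
  step : ∀ {u w v} → adj G u w ≡ true → Reach G w v → Reach G u v

Connected : ∀ {n} → Graph n → Set
Connected G = ∀ u v → Reach G u v

Chain : ∀ {n} → Graph n → List (Fin n) → Set
Chain G []           = Data.Unit.⊤ where import Data.Unit
Chain G (x ∷ [])     = Data.Unit.⊤ where import Data.Unit
Chain G (x ∷ y ∷ xs) = (adj G x y ≡ true) × Chain G (y ∷ xs)

IsCycle : ∀ {n} → Graph n → List (Fin n) → Set
IsCycle G []                   = ⊥
IsCycle G (_ ∷ [])             = ⊥
IsCycle G (_ ∷ _ ∷ [])         = ⊥
IsCycle G (v₀ ∷ v₁ ∷ v₂ ∷ vs) =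
  Unique (v₀ ∷ v₁ ∷ v₂ ∷ vs) × Chain G (v₀ ∷ v₁ ∷ v₂ ∷ vs)
  × (adj G (lastOf v₂ vs) v₀ ≡ true)
  where
  lastOf : _ → List _ → _
  lastOf x []       = x
  lastOf x (y ∷ ys) = lastOf y ys

Acyclic : ∀ {n} → Graph n → Set
Acyclic G = ∀ cs → IsCycle G cs → ⊥

IsTree : ∀ {n} → Graph n → Set
IsTree G = Connected G × Acyclic G

degree : ∀ {n} → Graph n → Fin n → ℕ
degree {n} G v = count (allFin n) (λ u → adj G v u)

numDeg : ∀ {n} → Graph n → ℕ → ℕ
numDeg {n} G b = count (allFin n) (λ v → degree G v ≡ᵇ b)

proper : ∀ {n k} → Graph n → (Fin n → Fin k) → Bool
proper {n} G κ =
  foldr _∧_ true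
    (concatMap (λ u → map (λ v → not (adj G u v ∧ ⌊ κ u ≟ κ v ⌋)) (allFin n)) (allFin n))

chromSym : ∀ {n} → Graph n → (k : ℕ) → (Fin k → ℤ) → ℤ
chromSym {n} G k x =
  Σℤ (allFuns n k) (λ κ → if proper G κ then Πℤ (allFin n) (λ v → x (κ v)) else 0ℤ)

-- partitions of m with all parts ≤ bound (fuel ≥ m suffices)
partsB : ℕ → ℕ → ℕ → List (List ℕ)
partsB _        zero    _     = [] ∷ []
partsB zero     (suc m) _     = []
partsB (suc f) (suc m) bound =
  concatMap (λ j → map (suc j ∷_) (partsB f (m ∸ j) (suc j)))
            (applyUpTo (λ j → j) (bound ⊓ suc m))

-- all partitions λ ⊢ n (each listed once, parts in weakly decreasing order)
partitions : ℕ → List (List ℕ)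
partitions n = partsB n n n

powerSum : List ℕ → (k : ℕ) → (Fin k → ℤ) → ℤ
powerSum λs k x = Πℤ λs (λ r → Σℤ (allFin k) (λ j → x j ℤ.^ r))

m₁ : List ℕ → ℕ
m₁ λs = count λs (λ r → r ≡ᵇ 1)

-- "X_T = Σ_{λ ⊢ n} c_λ p_λ": identity of symmetric functions, tested in every
-- finite number k of variables (as polynomial identities over ℤ)
IsPowerSumExpansion : ∀ {n} → Graph n → (List ℕ → ℤ) → Set
IsPowerSumExpansion {n} G c =
  ∀ (k : ℕ) (x : Fin k → ℤ) →
    chromSym G k x ≡ Σℤ (partitions n) (λ λs → c λs ℤ.* powerSum λs k x)

-- the summand (-1)^{n-b-1} m₁(λ) binom(n-ℓ(λ), n-b-1), which is 0 when n-b-1 < 0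
summand : ℕ → ℕ → List ℕ → ℤ
summand n b λs =
  if b <ᵇ n
  then (-1ℤ ℤ.^ (n ∸ b ∸ 1)) ℤ.* (+ m₁ λs) ℤ.* (+ ((n ∸ length λs) C (n ∸ b ∸ 1)))
  else 0ℤ

{-# OPTIONS --safe #-}

-- Evaluate X_T at (t, 1, …, 1) in a + 1 variables.  A proper colouring contributes t to the power
-- of the number of vertices of colour 0, so the coefficient of t counts the proper colourings in
-- which a single vertex v has colour 0.  Deleting a leaf other than v shows that a tree has
-- a ^ deg v * (a - 1) ^ (n - 1 - deg v) of them.  In p_λ(t, 1, …, 1) = Π_i (t ^ λ_i + a) the
-- coefficient of t is m₁(λ) a ^ (ℓ(λ) - 1), and a ^ j = a ^ j (a - (a - 1)) ^ (n - 1 - j) expands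
-- in the basis a ^ i (a - 1) ^ (n - 1 - i).  Since the resulting identity holds for every a ≥ 1,
-- the coefficients of a ^ b (a - 1) ^ (n - 1 - b) agree on both sides, and that is the formula.
-- Both coefficient comparisons only use values at integers, so they are done by divisibility.

module Submission where

open import Defs
open import Data.Nat using (ℕ)
open import Data.Integer using (ℤ; +_; _*_)
open import Data.List using (List)
open import Relation.Binary.PropositionalEquality using (_≡_)

open import Data.Bool using (Bool; true; false; if_then_else_; _∧_; _∨_; not)
import Data.Bool.Properties as 𝔹
open import Data.Nat as ℕ using (zero; suc; _∸_; _⊓_; _≡ᵇ_; z≤n; s≤s)
import Data.Nat.Properties as ℕP
import Data.Nat.Divisibility as ℕ∣
import Data.Integer as ℤ
open import Data.Integer using (0ℤ; 1ℤ; -1ℤ; _+_; _-_; _^_; ∣_∣)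
import Data.Integer.Properties as ℤP
open import Data.Integer.Divisibility.Signed
  using (_∣_; divides; ∣⇒∣ᵤ; ∣-refl; ∣m∣n⇒∣m+n; ∣m∣n⇒∣m-n; ∣n⇒∣m*n; ∣m⇒∣m*n)
open import Data.Integer.Tactic.RingSolver using (solve-∀)
open import Data.Fin as Fin using (Fin; zero; suc; punchIn; punchOut; toℕ)
open import Data.Fin.Properties
  using ( _≟_; toℕ≤pred[n]; any?; pigeonhole
        ; punchIn-punchOut; punchIn-injective; punchInᵢ≢i; punchOut-cong; punchOut-punchIn)
open import Data.List using ([]; _∷_; _++_; map; concatMap; tabulate; allFin; length; foldr; lookup)
open import Data.List.Properties using (++-assoc; length-filter; length-tabulate)
open import Data.List.Relation.Unary.All as All using (All; []; _∷_)
open import Data.List.Relation.Unary.Any using (here; there)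
open import Data.List.Membership.Propositional using (_∈_)
open import Data.List.Membership.Propositional.Properties using (∈-∃++; ∈-lookup)
import Data.List.Membership.DecPropositional as DecMembership
open import Data.List.Relation.Unary.AllPairs using ([]; _∷_)
open import Data.List.Relation.Unary.Unique.Propositional using (Unique)
import Data.List.Relation.Unary.Unique.Propositional.Properties as UniqueP
open UniqueP using (Unique[x∷xs]⇒x∉xs)
open import Data.List.Relation.Unary.All.Properties
  using (concat⁺; concat⁻; map⁺; map⁻; tabulate⁺; tabulate⁻; applyUpTo⁺₂; ¬Any⇒All¬)
  renaming (++⁻ˡ to All++⁻ˡ)
open import Data.Product using (Σ; ∃; ∃₂; _×_; _,_; proj₁; proj₂)
open import Function using (id; _∘_; _⇔_; mk⇔; Equivalence)
open import Data.Empty using (⊥; ⊥-elim)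
open import Data.Unit using (tt)
open import Relation.Binary.PropositionalEquality
  using (refl; sym; trans; cong; cong₂; subst; subst₂; _≢_; module ≡-Reasoning)
open import Relation.Nullary using (yes; no; does; ¬_; contradiction)
open import Relation.Nullary.Decidable using (⌊_⌋; dec-true; dec-false; _×-dec_; ¬?)

open import Algebra.Properties.Semiring.Sum ℤP.+-*-semiring
  using ( sum; sum-syntax; sum-cong-≗; sum-replicate-zero; sum-remove
        ; ∑-distrib-+; ∑-comm; *-distribˡ-sum; *-distribʳ-sum)
import Algebra.Properties.CommutativeMonoid.Sum as CommutativeMonoidSum
module Product = CommutativeMonoidSum ℤP.*-1-commutativeMonoid
open Product using () renaming (sum to product)
module ℕΣ = CommutativeMonoidSum ℕP.+-0-commutativeMonoid

import Algebra.Properties.CommutativeSemiring.Binomial ℤP.+-*-commutativeSemiring as Binomial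
open import Algebra.Properties.Semiring.Exp ℤP.+-*-semiring using () renaming (_^_ to _^′_)
open import Algebra.Properties.Semiring.Mult ℤP.+-*-semiring using () renaming (_×_ to _×′_)
open import Data.Nat.Combinatorics using (_C_; nCk≡nC[n∸k]; k>n⇒nCk≡0)

open ≡-Reasoning

Σℤ-cong : ∀ {A : Set} (xs : List A) {f g : A → ℤ} →
          (∀ x → f x ≡ g x) → Σℤ xs f ≡ Σℤ xs g
Σℤ-cong []       f≗g = refl
Σℤ-cong (x ∷ xs) f≗g = cong₂ _+_ (f≗g x) (Σℤ-cong xs f≗g)

Σℤ-congᴬ : ∀ {A : Set} {P : A → Set} {xs} {f g : A → ℤ} →
           All P xs → (∀ {x} → P x → f x ≡ g x) → Σℤ xs f ≡ Σℤ xs g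
Σℤ-congᴬ []         f≗g = refl
Σℤ-congᴬ (px ∷ pxs) f≗g = cong₂ _+_ (f≗g px) (Σℤ-congᴬ pxs f≗g)

Σℤ-zero : ∀ {A : Set} (xs : List A) {f : A → ℤ} → (∀ x → f x ≡ 0ℤ) → Σℤ xs f ≡ 0ℤ
Σℤ-zero []       f≡0 = refl
Σℤ-zero (x ∷ xs) f≡0 = cong₂ _+_ (f≡0 x) (Σℤ-zero xs f≡0)

*-distribˡ-Σℤ : ∀ {A : Set} c (xs : List A) f → c * Σℤ xs f ≡ Σℤ xs (λ x → c * f x)
*-distribˡ-Σℤ c []       f = ℤP.*-zeroʳ c
*-distribˡ-Σℤ c (x ∷ xs) f =
  trans (ℤP.*-distribˡ-+ c (f x) _) (cong (_+_ (c * f x)) (*-distribˡ-Σℤ c xs f))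

Σℤ-++ : ∀ {A : Set} (xs ys : List A) f → Σℤ (xs ++ ys) f ≡ Σℤ xs f + Σℤ ys f
Σℤ-++ []       ys f = sym (ℤP.+-identityˡ _)
Σℤ-++ (x ∷ xs) ys f = trans (cong (_+_ (f x)) (Σℤ-++ xs ys f)) (sym (ℤP.+-assoc (f x) _ _))

Σℤ-map : ∀ {A B : Set} (h : A → B) (xs : List A) f → Σℤ (map h xs) f ≡ Σℤ xs (f ∘ h)
Σℤ-map h []       f = refl
Σℤ-map h (x ∷ xs) f = cong (_+_ (f (h x))) (Σℤ-map h xs f)

Σℤ-concatMap : ∀ {A B : Set} (h : A → List B) (xs : List A) f →
               Σℤ (concatMap h xs) f ≡ Σℤ xs (λ x → Σℤ (h x) f)
Σℤ-concatMap h []       f = refl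
Σℤ-concatMap h (x ∷ xs) f =
  trans (Σℤ-++ (h x) (concatMap h xs) f) (cong (_+_ (Σℤ (h x) f)) (Σℤ-concatMap h xs f))

Σℤ-tabulate : ∀ {A : Set} {n} (g : Fin n → A) f → Σℤ (tabulate g) f ≡ ∑[ i < n ] f (g i)
Σℤ-tabulate {n = zero}  g f = refl
Σℤ-tabulate {n = suc n} g f = cong (_+_ (f (g zero))) (Σℤ-tabulate (g ∘ suc) f)

Πℤ-tabulate : ∀ {A : Set} {n} (g : Fin n → A) f → Πℤ (tabulate g) f ≡ product (f ∘ g)
Πℤ-tabulate {n = zero}  g f = refl
Πℤ-tabulate {n = suc n} g f = cong (_*_ (f (g zero))) (Πℤ-tabulate (g ∘ suc) f)

*-distribʳ-Σℤ : ∀ {A : Set} c (xs : List A) f → Σℤ xs f * c ≡ Σℤ xs (λ x → f x * c)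
*-distribʳ-Σℤ c xs f =
  trans (ℤP.*-comm _ c) (trans (*-distribˡ-Σℤ c xs f) (Σℤ-cong xs (λ x → ℤP.*-comm c (f x))))

Σℤ-∑-comm : ∀ {A : Set} (xs : List A) {n} (f : A → Fin n → ℤ) →
            Σℤ xs (λ x → ∑[ i < n ] f x i) ≡ ∑[ i < n ] Σℤ xs (λ x → f x i)
Σℤ-∑-comm []       {n} f = sym (sum-replicate-zero n)
Σℤ-∑-comm (x ∷ xs) f =
  trans (cong (_+_ (sum (f x))) (Σℤ-∑-comm xs f)) (sym (∑-distrib-+ (f x) _))

sum-ones : ∀ n → ∑[ i < n ] 1ℤ ≡ + n
sum-ones zero    = refl
sum-ones (suc n) = cong (_+_ 1ℤ) (sum-ones n)

if-∑ : ∀ b {n} (f : Fin n → ℤ) →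
       (if b then ∑[ i < n ] f i else 0ℤ) ≡ ∑[ i < n ] (if b then f i else 0ℤ)
if-∑ true      f = refl
if-∑ false {n} f = sym (sum-replicate-zero n)

Πℤ-const : ∀ {A : Set} x (xs : List A) → Πℤ xs (λ _ → x) ≡ x ^ length xs
Πℤ-const x []       = refl
Πℤ-const x (_ ∷ xs) = cong (x *_) (Πℤ-const x xs)

product-factor : ∀ {n} (f : Fin n → ℤ) i → ∃ λ R → product f ≡ f i * R
product-factor {suc n} f i = product (f ∘ punchIn i) , Product.sum-remove {i = i} f

cancel-difference : ∀ {x y A B} → x ≡ y + (A - B) → A ≡ B → x ≡ y
cancel-difference {y = y} {B = B} x≡ refl =
  trans x≡ (trans (cong (_+_ y) (ℤP.+-inverseʳ B)) (ℤP.+-identityʳ y))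

suc-∣⇒0 : ∀ n → suc n ℕ∣.∣ n → n ≡ 0
suc-∣⇒0 zero    _     = refl
suc-∣⇒0 (suc n) n+2∣n = contradiction (ℕ∣.∣⇒≤ n+2∣n) (ℕP.n≮n (suc n))

divisible-by-all⇒0 : ∀ {z} → (∀ m → + suc m ∣ z) → z ≡ 0ℤ
divisible-by-all⇒0 {z} ∣z = ℤP.∣i∣≡0⇒i≡0 (suc-∣⇒0 ∣ z ∣ (∣⇒∣ᵤ (∣z ∣ z ∣)))

^-distribʳ-* : ∀ x y n → (x * y) ^ n ≡ x ^ n * y ^ n
^-distribʳ-* x y zero    = refl
^-distribʳ-* x y (suc n) = trans (cong (x * y *_) (^-distribʳ-* x y n)) (swap x y (x ^ n) (y ^ n))
  where
  swap : ∀ x y p q → x * y * (p * q) ≡ x * p * (y * q)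
  swap = solve-∀

-1^n*-1^n≡1 : ∀ n → -1ℤ ^ n * -1ℤ ^ n ≡ 1ℤ
-1^n*-1^n≡1 n = trans (sym (^-distribʳ-* -1ℤ -1ℤ n)) (ℤP.^-zeroˡ n)

a∣[a-1]^n-[-1]^n : ∀ a n → a ∣ (a - 1ℤ) ^ n - -1ℤ ^ n
a∣[a-1]^n-[-1]^n a zero    = divides 0ℤ refl
a∣[a-1]^n-[-1]^n a (suc n) = subst (a ∣_) (expand a ((a - 1ℤ) ^ n) (-1ℤ ^ n))
  (∣m∣n⇒∣m+n (∣n⇒∣m*n (a - 1ℤ) (a∣[a-1]^n-[-1]^n a n))
              (∣m⇒∣m*n (-1ℤ ^ n) ∣-refl))
  where
  expand : ∀ a p s → (a - 1ℤ) * (p - s) + a * s ≡ (a - 1ℤ) * p - -1ℤ * s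
  expand = solve-∀

∣*[a-1]^n⇒∣ : ∀ {a z} n → a ∣ z * (a - 1ℤ) ^ n → a ∣ z
∣*[a-1]^n⇒∣ {a} {z} n a∣ =
  subst (a ∣_) z≡
    (∣m⇒∣m*n (-1ℤ ^ n) (∣m∣n⇒∣m-n a∣ (∣n⇒∣m*n z (a∣[a-1]^n-[-1]^n a n))))
  where
  expand : ∀ z p s → (z * p - z * (p - s)) * s ≡ z * (s * s)
  expand = solve-∀
  z≡ : (z * (a - 1ℤ) ^ n - z * ((a - 1ℤ) ^ n - -1ℤ ^ n)) * -1ℤ ^ n ≡ z
  z≡ = trans (expand z _ _) (trans (cong (z *_) (-1^n*-1^n≡1 n)) (ℤP.*-identityʳ z))

-- First-order expansions at t = 0

HasJet : (ℤ → ℤ) → ℤ → ℤ → Set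
HasJet P p₀ p₁ = Σ (ℤ → ℤ) λ Q → ∀ t → P t ≡ p₀ + t * p₁ + t * t * Q t

jet-const : ∀ c → HasJet (λ _ → c) c 0ℤ
jet-const c = (λ _ → 0ℤ) , λ t → expand c t
  where
  expand : ∀ c t → c ≡ c + t * 0ℤ + t * t * 0ℤ
  expand = solve-∀

jet-cong : ∀ {P R p₀ p₁} → (∀ t → P t ≡ R t) → HasJet P p₀ p₁ → HasJet R p₀ p₁
jet-cong P≗R (Q , P≡) = Q , λ t → trans (sym (P≗R t)) (P≡ t)

jet-+ : ∀ {P R p₀ p₁ r₀ r₁} → HasJet P p₀ p₁ → HasJet R r₀ r₁ →
        HasJet (λ t → P t + R t) (p₀ + r₀) (p₁ + r₁)
jet-+ {p₀ = p₀} {p₁} {r₀} {r₁} (Q , P≡) (S , R≡) =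
  (λ t → Q t + S t) ,
  λ t → trans (cong₂ _+_ (P≡ t) (R≡ t)) (expand p₀ p₁ (Q t) r₀ r₁ (S t) t)
  where
  expand : ∀ p₀ p₁ q r₀ r₁ s t →
    p₀ + t * p₁ + t * t * q + (r₀ + t * r₁ + t * t * s) ≡
    p₀ + r₀ + t * (p₁ + r₁) + t * t * (q + s)
  expand = solve-∀

jet-* : ∀ {P R p₀ p₁ r₀ r₁} → HasJet P p₀ p₁ → HasJet R r₀ r₁ →
        HasJet (λ t → P t * R t) (p₀ * r₀) (p₁ * r₀ + p₀ * r₁)
jet-* {p₀ = p₀} {p₁} {r₀} {r₁} (Q , P≡) (S , R≡) =
  (λ t → p₀ * S t + p₁ * r₁ + Q t * r₀ + t * (p₁ * S t + Q t * r₁) + t * t * (Q t * S t)) ,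
  λ t → trans (cong₂ _*_ (P≡ t) (R≡ t)) (expand p₀ p₁ (Q t) r₀ r₁ (S t) t)
  where
  expand : ∀ p₀ p₁ q r₀ r₁ s t →
    (p₀ + t * p₁ + t * t * q) * (r₀ + t * r₁ + t * t * s) ≡
    p₀ * r₀ + t * (p₁ * r₀ + p₀ * r₁) +
    t * t * (p₀ * s + p₁ * r₁ + q * r₀ + t * (p₁ * s + q * r₁) + t * t * (q * s))
  expand = solve-∀

jet-*ˡ : ∀ c {P p₀ p₁} → HasJet P p₀ p₁ → HasJet (λ t → c * P t) (c * p₀) (c * p₁)
jet-*ˡ c {p₀ = p₀} {p₁} (Q , P≡) =
  (λ t → c * Q t) , λ t → trans (cong (c *_) (P≡ t)) (expand c p₀ p₁ (Q t) t)
  where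
  expand : ∀ c p₀ p₁ q t →
    c * (p₀ + t * p₁ + t * t * q) ≡ c * p₀ + t * (c * p₁) + t * t * (c * q)
  expand = solve-∀

jet-if : ∀ b {P p₀ p₁} → HasJet P p₀ p₁ →
         HasJet (λ t → if b then P t else 0ℤ) (if b then p₀ else 0ℤ) (if b then p₁ else 0ℤ)
jet-if true  jet = jet
jet-if false jet = jet-const 0ℤ

jet-Σℤ : ∀ {A : Set} {xs : List A} {F : A → ℤ → ℤ} {f₀ f₁ : A → ℤ} →
         All (λ x → HasJet (F x) (f₀ x) (f₁ x)) xs →
         HasJet (λ t → Σℤ xs (λ x → F x t)) (Σℤ xs f₀) (Σℤ xs f₁)
jet-Σℤ []           = jet-const 0ℤ
jet-Σℤ {xs = x ∷ xs} {F} {f₀} {f₁} (jet ∷ jets) =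
  jet-+ {p₀ = f₀ x} {f₁ x} jet (jet-Σℤ {xs = xs} {F} {f₀} {f₁} jets)

∂Π : ∀ {A : Set} → List A → (A → ℤ) → (A → ℤ) → ℤ
∂Π []       f₀ f₁ = 0ℤ
∂Π (x ∷ xs) f₀ f₁ = f₁ x * Πℤ xs f₀ + f₀ x * ∂Π xs f₀ f₁

jet-Πℤ : ∀ {A : Set} {xs : List A} {F : A → ℤ → ℤ} {f₀ f₁ : A → ℤ} →
         All (λ x → HasJet (F x) (f₀ x) (f₁ x)) xs →
         HasJet (λ t → Πℤ xs (λ x → F x t)) (Πℤ xs f₀) (∂Π xs f₀ f₁)
jet-Πℤ []           = jet-const 1ℤ
jet-Πℤ {xs = x ∷ xs} {F} {f₀} {f₁} (jet ∷ jets) =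
  jet-* {p₀ = f₀ x} {f₁ x} jet (jet-Πℤ {xs = xs} {F} {f₀} {f₁} jets)

jet-unique : ∀ {P p₀ p₁ q₀ q₁} → HasJet P p₀ p₁ → HasJet P q₀ q₁ → p₁ ≡ q₁
jet-unique {p₀ = p₀} {p₁} {q₀} {q₁} (Q , P≡) (R , P≡′) =
  ℤP.i-j≡0⇒i≡j p₁ q₁ (divisible-by-all⇒0 λ m →
    let t = + suc m in divides (R t - Q t) (difference t))
  where
  at0 : ∀ c d e → c + 0ℤ * d + 0ℤ * 0ℤ * e ≡ c
  at0 = solve-∀
  p₀≡q₀ : p₀ ≡ q₀
  p₀≡q₀ = trans (sym (at0 p₀ p₁ (Q 0ℤ)))
                (trans (sym (P≡ 0ℤ)) (trans (P≡′ 0ℤ) (at0 q₀ q₁ (R 0ℤ))))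
  rearrange : ∀ p₀ p₁ q₁ q r t → t * (p₁ - q₁) ≡
    t * ((r - q) * t) + ((p₀ + t * p₁ + t * t * q) - (p₀ + t * q₁ + t * t * r))
  rearrange = solve-∀
  difference : ∀ t .{{_ : ℤ.NonZero t}} → p₁ - q₁ ≡ (R t - Q t) * t
  difference t = ℤP.*-cancelˡ-≡ t _ _ (cancel-difference (rearrange p₀ p₁ q₁ (Q t) (R t) t)
    (trans (sym (P≡ t)) (trans (P≡′ t)
      (cong (λ x → x + t * q₁ + t * t * R t) (sym p₀≡q₀)))))

-- The basis a ^ i * (a - 1) ^ (N - i) of polynomials of degree at most N

basis : ℕ → ℤ → ℕ → ℤ
basis N a i = a ^ i * (a - 1ℤ) ^ (N ∸ i)

basisSum : ℕ → (ℕ → ℤ) → ℤ → ℤ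
basisSum N f a = ∑[ i < suc N ] (f (toℕ i) * basis N a (toℕ i))

basisSum-cong : ∀ N {f g} a → (∀ {i} → i ℕ.≤ N → f i ≡ g i) →
                basisSum N f a ≡ basisSum N g a
basisSum-cong N a f≗g =
  sum-cong-≗ {suc N} (λ i → cong (_* basis N a (toℕ i)) (f≗g (toℕ≤pred[n] i)))

basisSum-*ˡ : ∀ N c f a → basisSum N (λ i → c * f i) a ≡ c * basisSum N f a
basisSum-*ˡ N c f a =
  trans (sum-cong-≗ {suc N} (λ i → ℤP.*-assoc c (f (toℕ i)) (basis N a (toℕ i))))
        (sym (*-distribˡ-sum {suc N} c (λ i → f (toℕ i) * basis N a (toℕ i))))

basisSum-Σℤ : ∀ {A : Set} N (xs : List A) (h : A → ℕ → ℤ) a →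
              basisSum N (λ i → Σℤ xs (λ x → h x i)) a ≡ Σℤ xs (λ x → basisSum N (h x) a)
basisSum-Σℤ N xs h a =
  trans (sum-cong-≗ {suc N} λ i → *-distribʳ-Σℤ (basis N a (toℕ i)) xs (λ x → h x (toℕ i)))
        (sym (Σℤ-∑-comm xs {suc N} (λ x i → h x (toℕ i) * basis N a (toℕ i))))

basisSum-∑ : ∀ N {n} (h : Fin n → ℕ → ℤ) a →
             basisSum N (λ i → ∑[ v < n ] h v i) a ≡ ∑[ v < n ] basisSum N (h v) a
basisSum-∑ N h a =
  trans (sum-cong-≗ {suc N} λ i → *-distribʳ-sum (basis N a (toℕ i)) (λ v → h v (toℕ i)))
        (∑-comm {suc N} (λ i v → h v (toℕ i) * basis N a (toℕ i)))

basisSum-zero : ∀ f a → basisSum 0 f a ≡ f 0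
basisSum-zero f a = simplify (f 0)
  where
  simplify : ∀ x → x * (1ℤ * 1ℤ) + 0ℤ ≡ x
  simplify = solve-∀

basisSum-suc : ∀ N f a →
  basisSum (suc N) f a ≡ f 0 * (a - 1ℤ) ^ suc N + a * basisSum N (f ∘ suc) a
basisSum-suc N f a = cong₂ _+_ (cong (f 0 *_) (ℤP.*-identityˡ _))
  (trans (sum-cong-≗ {suc N} λ i →
            rotate (f (suc (toℕ i))) a (a ^ toℕ i) ((a - 1ℤ) ^ (N ∸ toℕ i)))
         (sym (*-distribˡ-sum {suc N} a (λ i → f (suc (toℕ i)) * basis N a (toℕ i)))))
  where
  rotate : ∀ x a p q → x * (a * p * q) ≡ a * (x * (p * q))
  rotate = solve-∀

basisSum-indicator : ∀ N {d} a → d ℕ.≤ N →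
  basisSum N (λ i → if d ≡ᵇ i then 1ℤ else 0ℤ) a ≡ a ^ d * (a - 1ℤ) ^ (N ∸ d)
basisSum-indicator zero    a z≤n = basisSum-zero (λ i → if 0 ≡ᵇ i then 1ℤ else 0ℤ) a
basisSum-indicator (suc N) a z≤n = begin
  basisSum (suc N) (λ i → if 0 ≡ᵇ i then 1ℤ else 0ℤ) a
    ≡⟨ basisSum-suc N (λ i → if 0 ≡ᵇ i then 1ℤ else 0ℤ) a ⟩
  1ℤ * (a - 1ℤ) ^ suc N + a * basisSum N (λ _ → 0ℤ) a
    ≡⟨ cong (λ x → 1ℤ * (a - 1ℤ) ^ suc N + a * x) (sum-replicate-zero (suc N)) ⟩
  1ℤ * (a - 1ℤ) ^ suc N + a * 0ℤ
    ≡⟨ simplify _ a ⟩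
  1ℤ * (a - 1ℤ) ^ suc N ∎
  where
  simplify : ∀ x a → x + a * 0ℤ ≡ x
  simplify = solve-∀
basisSum-indicator (suc N) {suc d} a (s≤s d≤N) = begin
  basisSum (suc N) (λ i → if suc d ≡ᵇ i then 1ℤ else 0ℤ) a
    ≡⟨ basisSum-suc N (λ i → if suc d ≡ᵇ i then 1ℤ else 0ℤ) a ⟩
  0ℤ + a * basisSum N (λ i → if d ≡ᵇ i then 1ℤ else 0ℤ) a
    ≡⟨ ℤP.+-identityˡ _ ⟩
  a * basisSum N (λ i → if d ≡ᵇ i then 1ℤ else 0ℤ) a
    ≡⟨ cong (a *_) (basisSum-indicator N a d≤N) ⟩
  a * (a ^ d * (a - 1ℤ) ^ (N ∸ d))
    ≡⟨ sym (ℤP.*-assoc a _ _) ⟩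
  a * a ^ d * (a - 1ℤ) ^ (N ∸ d) ∎

^′≡^ : ∀ x n → x ^′ n ≡ x ^ n
^′≡^ x zero    = refl
^′≡^ x (suc n) = cong (x *_) (^′≡^ x n)

×′≡* : ∀ n x → n ×′ x ≡ + n * x
×′≡* zero    x = refl
×′≡* (suc n) x = trans (cong (_+_ x) (×′≡* n x)) (sym (ℤP.suc-* (+ n) x))

-- a ^ j = a ^ j * (a - (a - 1)) ^ (N - j), expanded by the binomial theorem
basisCoefficient : ℕ → ℕ → ℕ → ℤ
basisCoefficient N j i = -1ℤ ^ (N ∸ i) * + ((N ∸ j) C (N ∸ i))

basisSum-one : ∀ N a → basisSum N (basisCoefficient N 0) a ≡ 1ℤ
basisSum-one N a = begin
  basisSum N (basisCoefficient N 0) a       ≡⟨ sum-cong-≗ {suc N} (term ∘ toℕ≤pred[n]) ⟩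
  Binomial.binomialExpansion a (1ℤ - a) N   ≡⟨ sym (Binomial.theorem N a (1ℤ - a)) ⟩
  (a + (1ℤ - a)) ^′ N                       ≡⟨ ^′≡^ (a + (1ℤ - a)) N ⟩
  (a + (1ℤ - a)) ^ N                        ≡⟨ cong (_^ N) (cancel a) ⟩
  1ℤ ^ N                                    ≡⟨ ℤP.^-zeroˡ N ⟩
  1ℤ                                        ∎
  where
  cancel : ∀ a → a + (1ℤ - a) ≡ 1ℤ
  cancel = solve-∀
  rearrange : ∀ s c p q → s * c * (p * q) ≡ c * (p * (s * q))
  rearrange = solve-∀
  negate : ∀ a → 1ℤ - a ≡ -1ℤ * (a - 1ℤ)
  negate = solve-∀
  term : ∀ {i} → i ℕ.≤ N →
         basisCoefficient N 0 i * basis N a i ≡ (N C i) ×′ (a ^′ i * (1ℤ - a) ^′ (N ∸ i))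
  term {i} i≤N = sym (begin
    (N C i) ×′ (a ^′ i * (1ℤ - a) ^′ (N ∸ i))
      ≡⟨ ×′≡* (N C i) _ ⟩
    + (N C i) * (a ^′ i * (1ℤ - a) ^′ (N ∸ i))
      ≡⟨ cong₂ (λ c x → + c * x) (nCk≡nC[n∸k] i≤N)
               (cong₂ _*_ (^′≡^ a i) (^′≡^ (1ℤ - a) (N ∸ i))) ⟩
    + (N C (N ∸ i)) * (a ^ i * (1ℤ - a) ^ (N ∸ i))
      ≡⟨ cong (λ x → + (N C (N ∸ i)) * (a ^ i * x))
              (trans (cong (_^ (N ∸ i)) (negate a)) (^-distribʳ-* -1ℤ (a - 1ℤ) (N ∸ i))) ⟩
    + (N C (N ∸ i)) * (a ^ i * (-1ℤ ^ (N ∸ i) * (a - 1ℤ) ^ (N ∸ i)))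
      ≡⟨ sym (rearrange (-1ℤ ^ (N ∸ i)) (+ (N C (N ∸ i))) (a ^ i) ((a - 1ℤ) ^ (N ∸ i))) ⟩
    basisCoefficient N 0 i * basis N a i ∎)

basisSum-pow : ∀ N {j} a → j ℕ.≤ N → basisSum N (basisCoefficient N j) a ≡ a ^ j
basisSum-pow N       a z≤n = basisSum-one N a
basisSum-pow (suc N) {suc j} a (s≤s j≤N) = begin
  basisSum (suc N) (basisCoefficient (suc N) (suc j)) a
    ≡⟨ basisSum-suc N (basisCoefficient (suc N) (suc j)) a ⟩
  -1ℤ ^ suc N * + ((N ∸ j) C suc N) * (a - 1ℤ) ^ suc N + a * basisSum N (basisCoefficient N j) a
    ≡⟨ cong (λ c → -1ℤ ^ suc N * + c * (a - 1ℤ) ^ suc N + a * basisSum N (basisCoefficient N j) a)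
            (k>n⇒nCk≡0 (s≤s (ℕP.m∸n≤m N j))) ⟩
  -1ℤ ^ suc N * 0ℤ * (a - 1ℤ) ^ suc N + a * basisSum N (basisCoefficient N j) a
    ≡⟨ simplify (-1ℤ ^ suc N) ((a - 1ℤ) ^ suc N) _ ⟩
  a * basisSum N (basisCoefficient N j) a
    ≡⟨ cong (a *_) (basisSum-pow N a j≤N) ⟩
  a * a ^ j ∎
  where
  simplify : ∀ s p x → s * 0ℤ * p + x ≡ x
  simplify = solve-∀

basisSum-injective : ∀ N {f g} → (∀ m → basisSum N f (+ suc m) ≡ basisSum N g (+ suc m)) →
                     ∀ {i} → i ℕ.≤ N → f i ≡ g i
basisSum-injective zero {f} {g} f≈g z≤n =
  trans (sym (basisSum-zero f 1ℤ)) (trans (f≈g 0) (basisSum-zero g 1ℤ))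
basisSum-injective (suc N) {f} {g} f≈g = coefficients
  where
  P F G : ℕ → ℤ
  P m = (+ suc m - 1ℤ) ^ suc N
  F m = basisSum N (f ∘ suc) (+ suc m)
  G m = basisSum N (g ∘ suc) (+ suc m)
  split : ∀ m → f 0 * P m + + suc m * F m ≡ g 0 * P m + + suc m * G m
  split m = trans (sym (basisSum-suc N f (+ suc m))) (trans (f≈g m) (basisSum-suc N g (+ suc m)))
  rearrangeHead : ∀ f₀ g₀ p a x y →
    (f₀ - g₀) * p ≡ (y - x) * a + ((f₀ * p + a * x) - (g₀ * p + a * y))
  rearrangeHead = solve-∀
  rearrangeTail : ∀ f₀ p a x y → a * x ≡ a * y + ((f₀ * p + a * x) - (f₀ * p + a * y))
  rearrangeTail = solve-∀
  head : f 0 ≡ g 0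
  head = ℤP.i-j≡0⇒i≡j _ _ (divisible-by-all⇒0 λ m → ∣*[a-1]^n⇒∣ (suc N) (divides (G m - F m)
    (cancel-difference (rearrangeHead (f 0) (g 0) (P m) (+ suc m) (F m) (G m)) (split m))))
  tail : ∀ m → F m ≡ G m
  tail m = ℤP.*-cancelˡ-≡ (+ suc m) (F m) (G m)
    (cancel-difference (rearrangeTail (g 0) (P m) (+ suc m) (F m) (G m))
      (trans (cong (λ x → x * P m + + suc m * F m) (sym head)) (split m)))
  coefficients : ∀ {i} → i ℕ.≤ suc N → f i ≡ g i
  coefficients z≤n       = head
  coefficients (s≤s i≤N) = basisSum-injective N {f ∘ suc} {g ∘ suc} tail i≤N

ProperColouring : ∀ {n k} → Graph n → (Fin n → Fin k) → Set
ProperColouring G κ = ∀ u w → adj G u w ≡ true → κ u ≢ κ w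

and⇒All : ∀ bs → foldr _∧_ true bs ≡ true → All (_≡ true) bs
and⇒All []          _   = []
and⇒All (true ∷ bs) all = refl ∷ and⇒All bs all

All⇒and : ∀ {bs} → All (_≡ true) bs → foldr _∧_ true bs ≡ true
All⇒and []          = refl
All⇒and (refl ∷ ps) = All⇒and ps

proper-sound : ∀ {n k} {G : Graph n} {κ : Fin n → Fin k} →
               proper G κ ≡ true → ProperColouring G κ
proper-sound {G = G} {κ} ok u w uw =
  edge-ok (adj G u w) (tabulate⁻ (map⁻ (tabulate⁻ (map⁻ (concat⁻ (and⇒All _ ok))) u)) w) uw
  where
  edge-ok : ∀ b → not (b ∧ ⌊ κ u ≟ κ w ⌋) ≡ true → b ≡ true → κ u ≢ κ w
  edge-ok true ok refl with κ u ≟ κ w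
  ... | no κu≢κw = κu≢κw
  ... | yes _    = contradiction ok λ ()

proper-complete : ∀ {n k} {G : Graph n} {κ : Fin n → Fin k} →
                  ProperColouring G κ → proper G κ ≡ true
proper-complete {G = G} {κ} proper = All⇒and (concat⁺ (map⁺ (tabulate⁺ λ u →
  map⁺ (tabulate⁺ λ w → edge-ok (adj G u w) (proper u w)))))
  where
  edge-ok : ∀ {u w} b → (b ≡ true → κ u ≢ κ w) → not (b ∧ ⌊ κ u ≟ κ w ⌋) ≡ true
  edge-ok false _  = refl
  edge-ok {u} {w} true ok with κ u ≟ κ w
  ... | yes κu≡κw = contradiction κu≡κw (ok refl)
  ... | no _      = refl

proper-≡ : ∀ {m n k} {G : Graph m} {H : Graph n} {κ : Fin m → Fin k} {λ′ : Fin n → Fin k} →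
           (ProperColouring G κ → ProperColouring H λ′) →
           (ProperColouring H λ′ → ProperColouring G κ) →
           proper G κ ≡ proper H λ′
proper-≡ {G = G} {H} {κ} {λ′} G→H H→G = 𝔹.⇔→≡ (mk⇔
  (proper-complete {G = H} {λ′} ∘ G→H ∘ proper-sound {G = G} {κ})
  (proper-complete {G = G} {κ} ∘ H→G ∘ proper-sound {G = H} {λ′}))

removeVertex : ∀ {n} → Graph (suc n) → Fin (suc n) → Graph n
removeVertex G ℓ = record
  { adj    = λ u w → adj G (punchIn ℓ u) (punchIn ℓ w)
  ; symm   = λ u w → symm G (punchIn ℓ u) (punchIn ℓ w)
  ; irrefl = λ u → irrefl G (punchIn ℓ u)
  }

data PunchView {n} (ℓ : Fin (suc n)) : Fin (suc n) → Set where
  pivot   : PunchView ℓ ℓ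
  punched : ∀ u → PunchView ℓ (punchIn ℓ u)

punchView : ∀ {n} (ℓ u : Fin (suc n)) → PunchView ℓ u
punchView ℓ u with ℓ ≟ u
... | yes refl = pivot
... | no ℓ≢u   = subst (PunchView ℓ) (punchIn-punchOut ℓ≢u) (punched (punchOut ℓ≢u))

punchIn-≟ : ∀ {n} (ℓ : Fin (suc n)) u v → does (punchIn ℓ u ≟ punchIn ℓ v) ≡ does (u ≟ v)
punchIn-≟ ℓ u v with u ≟ v
... | yes refl = dec-true (punchIn ℓ u ≟ punchIn ℓ u) refl
... | no u≢v   = dec-false (punchIn ℓ u ≟ punchIn ℓ v) (u≢v ∘ punchIn-injective ℓ u v)

IsLeaf : ∀ {n} → Graph n → Fin n → Fin n → Set
IsLeaf G ℓ p = adj G ℓ p ≡ true × (∀ w → adj G ℓ w ≡ true → w ≡ p)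

-- Vertex insertion built from consF rather than Data.Vec.Functional.insertAt, so that the sum
-- over allFuns splits at ℓ definitionally (Σ-allFuns-insert).
insert : ∀ {n k} → Fin (suc n) → Fin k → (Fin n → Fin k) → Fin (suc n) → Fin k
insert           zero    c κ = consF c κ
insert {suc n}   (suc ℓ) c κ = consF (κ zero) (insert ℓ c (κ ∘ suc))

insert-pivot : ∀ {n k} (ℓ : Fin (suc n)) (c : Fin k) κ → insert ℓ c κ ℓ ≡ c
insert-pivot           zero    c κ = refl
insert-pivot {suc n}   (suc ℓ) c κ = insert-pivot ℓ c (κ ∘ suc)

insert-punchIn : ∀ {n k} (ℓ : Fin (suc n)) (c : Fin k) κ u → insert ℓ c κ (punchIn ℓ u) ≡ κ u
insert-punchIn           zero    c κ u       = refl
insert-punchIn {suc n}   (suc ℓ) c κ zero    = refl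
insert-punchIn {suc n}   (suc ℓ) c κ (suc u) = insert-punchIn ℓ c (κ ∘ suc) u

proper-insert : ∀ {n k} {G : Graph (suc n)} {ℓ p} → IsLeaf G ℓ (punchIn ℓ p) →
                ∀ (c : Fin k) κ →
                proper G (insert ℓ c κ) ≡ proper (removeVertex G ℓ) κ ∧ not (does (c ≟ κ p))
proper-insert {G = G} {ℓ} {p} (ℓp , onlyp) c κ with c ≟ κ p
... | yes refl = trans
  (𝔹.¬-not λ ok → proper-sound {G = G} {insert ℓ c κ} ok ℓ (punchIn ℓ p) ℓp
                    (trans (insert-pivot ℓ c κ) (sym (insert-punchIn ℓ c κ p))))
  (sym (𝔹.∧-zeroʳ _))
... | no c≢κp  =
  trans (proper-≡ {G = G} {removeVertex G ℓ} restrict extend) (sym (𝔹.∧-identityʳ _))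
  where
  restrict : ProperColouring G (insert ℓ c κ) → ProperColouring (removeVertex G ℓ) κ
  restrict ok u w uw κu≡κw = ok (punchIn ℓ u) (punchIn ℓ w) uw
    (trans (insert-punchIn ℓ c κ u) (trans κu≡κw (sym (insert-punchIn ℓ c κ w))))
  extend : ProperColouring (removeVertex G ℓ) κ → ProperColouring G (insert ℓ c κ)
  extend ok u w uw with punchView ℓ u | punchView ℓ w
  ... | pivot      | pivot      = contradiction (trans (sym uw) (irrefl G ℓ)) λ ()
  ... | pivot      | punched w′ = λ eq → c≢κp (begin
    c                           ≡⟨ insert-pivot ℓ c κ ⟨
    insert ℓ c κ ℓ              ≡⟨ eq ⟩
    insert ℓ c κ (punchIn ℓ w′) ≡⟨ insert-punchIn ℓ c κ w′ ⟩
    κ w′                        ≡⟨ cong κ (punchIn-injective ℓ w′ p (onlyp _ uw)) ⟩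
    κ p                         ∎)
  ... | punched u′ | pivot      = λ eq → c≢κp (begin
    c                           ≡⟨ insert-pivot ℓ c κ ⟨
    insert ℓ c κ ℓ              ≡⟨ eq ⟨
    insert ℓ c κ (punchIn ℓ u′) ≡⟨ insert-punchIn ℓ c κ u′ ⟩
    κ u′                        ≡⟨ cong κ (punchIn-injective ℓ u′ p (onlyp _ (trans (symm G ℓ _) uw))) ⟩
    κ p                         ∎)
  ... | punched u′ | punched w′ = λ eq → ok u′ w′ uw
    (trans (sym (insert-punchIn ℓ c κ u′)) (trans eq (insert-punchIn ℓ c κ w′)))

lastOr : ∀ {A : Set} → A → List A → A
lastOr x []       = x
lastOr x (y ∷ ys) = lastOr y ys

lastOr-∷ʳ : ∀ {A : Set} (x : A) xs y → lastOr x (xs ++ y ∷ []) ≡ y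
lastOr-∷ʳ x []       y = refl
lastOr-∷ʳ x (z ∷ zs) y = lastOr-∷ʳ z zs y

lastOr-map : ∀ {A B : Set} (f : A → B) x xs → lastOr (f x) (map f xs) ≡ f (lastOr x xs)
lastOr-map f x []       = refl
lastOr-map f x (y ∷ ys) = lastOr-map f y ys

chain-⊆ : ∀ {n} {H G : Graph n} → (∀ u w → adj H u w ≡ true → adj G u w ≡ true) →
          ∀ {xs} → Chain H xs → Chain G xs
chain-⊆ H⊆G {[]}         c        = c
chain-⊆ H⊆G {_ ∷ []}     c        = c
chain-⊆ H⊆G {_ ∷ _ ∷ _} (e , c)  = H⊆G _ _ e , chain-⊆ H⊆G c

chain-map : ∀ {m n} {H : Graph m} {G : Graph n} (f : Fin m → Fin n) →
            (∀ u w → adj H u w ≡ true → adj G (f u) (f w) ≡ true) →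
            ∀ {xs} → Chain H xs → Chain G (map f xs)
chain-map f hom {[]}         c       = c
chain-map f hom {_ ∷ []}     c       = c
chain-map f hom {_ ∷ _ ∷ _} (e , c) = hom _ _ e , chain-map f hom c

addEdge : ∀ {n} (G : Graph n) x y → x ≢ y → Graph n
addEdge G x y x≢y = record
  { adj    = λ u w → adj G u w ∨ new u w
  ; symm   = λ u w → cong₂ _∨_ (symm G u w) (trans (𝔹.∨-comm (does (u ≟ x) ∧ does (w ≟ y)) _)
                       (cong₂ _∨_ (𝔹.∧-comm (does (u ≟ y)) _) (𝔹.∧-comm (does (u ≟ x)) _)))
  ; irrefl = no-loop
  }
  where
  new : _ → _ → Bool
  new u w = does (u ≟ x) ∧ does (w ≟ y) ∨ does (u ≟ y) ∧ does (w ≟ x)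
  no-loop : ∀ v → adj G v v ∨ new v v ≡ false
  no-loop v rewrite irrefl G v with v ≟ x | v ≟ y
  ... | yes refl | yes refl = contradiction refl x≢y
  ... | yes _    | no _     = refl
  ... | no _     | yes _    = refl
  ... | no _     | no _     = refl

module _ {n} {G : Graph n} {x y : Fin n} {x≢y : x ≢ y} where

  addEdge-⊇ : ∀ u w → adj G u w ≡ true → adj (addEdge G x y x≢y) u w ≡ true
  addEdge-⊇ u w uw = cong (_∨ _) uw

  addEdge-new : adj (addEdge G x y x≢y) x y ≡ true
  addEdge-new rewrite dec-true (x ≟ x) refl | dec-true (y ≟ y) refl = 𝔹.∨-zeroʳ (adj G x y)

  addEdge-⊆ : ∀ {z v} → v ≢ x → v ≢ y → adj (addEdge G x y x≢y) z v ≡ true → adj G z v ≡ true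
  addEdge-⊆ {z} {v} v≢x v≢y zv
    rewrite dec-false (v ≟ x) v≢x | dec-false (v ≟ y) v≢y
          | 𝔹.∧-zeroʳ (does (z ≟ x)) | 𝔹.∧-zeroʳ (does (z ≟ y)) | 𝔹.∨-identityʳ (adj G z v)
          = zv

-- Defs computes the closing vertex of a cycle with a local function that cannot be named
-- here, so it is related to lastOr by shortening the cycle along a chord v₁ — v₃.
IsCycle⇔ : ∀ {n} {G : Graph n} {v₀ v₁ v₂ vs} →
           IsCycle G (v₀ ∷ v₁ ∷ v₂ ∷ vs) ⇔
           ( Unique (v₀ ∷ v₁ ∷ v₂ ∷ vs) × Chain G (v₀ ∷ v₁ ∷ v₂ ∷ vs)
           × adj G (lastOr v₂ vs) v₀ ≡ true)
IsCycle⇔ = mk⇔ (λ cycle → proj₁ cycle , proj₁ (proj₂ cycle) , closes cycle)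
               (λ (u , c , a) → reopen u c a)
  where
  shorten : ∀ {A : Set} {v₀ v₁ v₂ v₃ : A} {vs} →
            Unique (v₀ ∷ v₁ ∷ v₂ ∷ v₃ ∷ vs) → Unique (v₀ ∷ v₁ ∷ v₃ ∷ vs)
  shorten ((v₀≢v₁ ∷ _ ∷ v₀∉) ∷ (_ ∷ v₁∉) ∷ _ ∷ u) = (v₀≢v₁ ∷ v₀∉) ∷ v₁∉ ∷ u

  closes : ∀ {n} {G : Graph n} {v₀ v₁ v₂ vs} →
           IsCycle G (v₀ ∷ v₁ ∷ v₂ ∷ vs) → adj G (lastOr v₂ vs) v₀ ≡ true
  closes {vs = []} (_ , _ , a) = a
  closes {G = G} {v₀} {v₁} {v₂} {v₃ ∷ vs}
         (u@((v₀≢v₁ ∷ _ ∷ v₀≢v₃ ∷ _) ∷ (_ ∷ v₁≢v₃ ∷ _) ∷ _) , (a₀₁ , _ , _ , c) , a) =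
    addEdge-⊆ {G = G} {x≢y = v₁≢v₃} v₀≢v₁ v₀≢v₃
      (closes {G = addEdge G v₁ v₃ v₁≢v₃} (shorten u , (⊇ _ _ a₀₁ , new , chain-⊆ ⊇ c) , ⊇ _ _ a))
    where
    ⊇ = addEdge-⊇ {G = G} {x≢y = v₁≢v₃}
    new = addEdge-new {G = G} {x≢y = v₁≢v₃}

  reopen : ∀ {n} {G : Graph n} {v₀ v₁ v₂ vs} →
           Unique (v₀ ∷ v₁ ∷ v₂ ∷ vs) → Chain G (v₀ ∷ v₁ ∷ v₂ ∷ vs) →
           adj G (lastOr v₂ vs) v₀ ≡ true → IsCycle G (v₀ ∷ v₁ ∷ v₂ ∷ vs)
  reopen {vs = []} u c a = u , c , a
  reopen {G = G} {v₀} {v₁} {v₂} {v₃ ∷ vs}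
         u@((v₀≢v₁ ∷ _ ∷ v₀≢v₃ ∷ _) ∷ (_ ∷ v₁≢v₃ ∷ _) ∷ _) c@(a₀₁ , _ , _ , c′) a =
    u , c , addEdge-⊆ {G = G} {x≢y = v₁≢v₃} v₀≢v₁ v₀≢v₃ (proj₂ (proj₂
      (reopen {G = addEdge G v₁ v₃ v₁≢v₃} (shorten u) (⊇ _ _ a₀₁ , new , chain-⊆ ⊇ c′) (⊇ _ _ a))))
    where
    ⊇ = addEdge-⊇ {G = G} {x≢y = v₁≢v₃}
    new = addEdge-new {G = G} {x≢y = v₁≢v₃}

lookup-injective : ∀ {A : Set} {xs : List A} → Unique xs →
                   ∀ {i j} → i Fin.< j → lookup xs i ≢ lookup xs j
lookup-injective {xs = _ ∷ _} (x∉ ∷ _) {zero}  {suc j} _         = All.lookup x∉ (∈-lookup j)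
lookup-injective {xs = _ ∷ _} (_ ∷ u)  {suc i} {suc j} (s≤s i<j) = lookup-injective u i<j

unique⇒length≤ : ∀ {n} {xs : List (Fin n)} → Unique xs → length xs ℕ.≤ n
unique⇒length≤ {n} {xs} u with length xs ℕ.≤? n
... | yes ≤n = ≤n
... | no  ≰n with pigeonhole (ℕP.≰⇒> ≰n) (lookup xs)
...   | i , j , i<j , same = contradiction same (lookup-injective u i<j)

unique-++⁻ˡ : ∀ {A : Set} (xs : List A) {ys} → Unique (xs ++ ys) → Unique xs
unique-++⁻ˡ []       _        = []
unique-++⁻ˡ (x ∷ xs) (x∉ ∷ u) = All++⁻ˡ xs x∉ ∷ unique-++⁻ˡ xs u

chain-++⁻ˡ : ∀ {n} {G : Graph n} xs {ys} → Chain G (xs ++ ys) → Chain G xs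
chain-++⁻ˡ []           _       = tt
chain-++⁻ˡ (x ∷ [])     _       = tt
chain-++⁻ˡ (x ∷ y ∷ xs) (e , c) = e , chain-++⁻ˡ (y ∷ xs) c

module _ {n} {G : Graph n} (acyclic : Acyclic G) where

  open DecMembership (_≟_ {n}) using (_∈?_)

  no-closed-path : ∀ {v₀ v₁} xs {y} → Unique (v₀ ∷ v₁ ∷ xs ++ y ∷ []) →
                   Chain G (v₀ ∷ v₁ ∷ xs ++ y ∷ []) → adj G y v₀ ≡ true → ⊥
  no-closed-path []           u c a = acyclic _ (Equivalence.from (IsCycle⇔ {G = G}) (u , c , a))
  no-closed-path {v₀} (x ∷ xs) {y} u c a = acyclic _ (Equivalence.from (IsCycle⇔ {G = G})
    (u , c , subst (λ z → adj G z v₀ ≡ true) (sym (lastOr-∷ʳ x xs y)) a))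

  path-neighbour : ∀ {w q rest y} → Unique (w ∷ q ∷ rest) → Chain G (w ∷ q ∷ rest) →
                   adj G w y ≡ true → y ∈ w ∷ q ∷ rest → y ≡ q
  path-neighbour _ _ wy (here refl)         = contradiction (trans (sym wy) (irrefl G _)) λ ()
  path-neighbour _ _ _  (there (here refl)) = refl
  path-neighbour {w} {q} {y = y} u c wy (there (there y∈rest)) with ∈-∃++ y∈rest
  ... | pre , post , refl = ⊥-elim (no-closed-path pre
          (unique-++⁻ˡ (w ∷ q ∷ pre ++ y ∷ []) (subst Unique (sym split) u))
          (chain-++⁻ˡ (w ∷ q ∷ pre ++ y ∷ []) (subst (Chain G) (sym split) c))
          (trans (symm G y w) wy))
    where
    split : (w ∷ q ∷ pre ++ y ∷ []) ++ post ≡ w ∷ q ∷ pre ++ y ∷ post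
    split = cong (λ zs → w ∷ q ∷ zs) (++-assoc pre (y ∷ []) post)

  -- A longest path ends in a leaf: extend the path at its head w while w has a neighbour off it.
  grow : ∀ fuel {v} w q rest → Unique (w ∷ q ∷ rest) → Chain G (w ∷ q ∷ rest) → v ∈ q ∷ rest →
         n ℕ.< fuel ℕ.+ length (w ∷ q ∷ rest) → ∃₂ λ ℓ p → IsLeaf G ℓ p × ℓ ≢ v
  grow zero        w q rest u c v∈ n< = contradiction (unique⇒length≤ u) (ℕP.<⇒≱ n<)
  grow (suc fuel)  w q rest u c v∈ n<
    with any? (λ y → (adj G w y 𝔹.≟ true) ×-dec ¬? (y ∈? w ∷ q ∷ rest))
  ... | yes (y , wy , y∉) =
    grow fuel y w (q ∷ rest) (¬Any⇒All¬ _ y∉ ∷ u) (trans (symm G y w) wy , c)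
         (there v∈) (subst (n ℕ.<_) (sym (ℕP.+-suc fuel _)) n<)
  ... | no  stuck         = w , q , (proj₁ c , λ y wy → path-neighbour u c wy (on-path y wy)) ,
                            λ { refl → Unique[x∷xs]⇒x∉xs u v∈ }
    where
    on-path : ∀ y → adj G w y ≡ true → y ∈ w ∷ q ∷ rest
    on-path y wy with y ∈? w ∷ q ∷ rest
    ... | yes y∈ = y∈
    ... | no  y∉ = contradiction (y , wy , y∉) stuck

  leaf-avoiding : ∀ {v w} → adj G v w ≡ true → ∃₂ λ ℓ p → IsLeaf G ℓ p × ℓ ≢ v
  leaf-avoiding {v} {w} vw =
    grow n w v [] ((w≢v ∷ []) ∷ [] ∷ []) (trans (symm G w v) vw , tt) (here refl)
         (ℕP.m<m+n n ℕ.z<s)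
    where
    w≢v : w ≢ v
    w≢v refl = contradiction (trans (sym vw) (irrefl G v)) λ ()

module _ {n} {G : Graph (suc n)} {ℓ p} (leaf : IsLeaf G ℓ (punchIn ℓ p)) where

  private
    G′ = removeVertex G ℓ

  leaf-neighbour : ∀ {x} → adj G ℓ (punchIn ℓ x) ≡ true → x ≡ p
  leaf-neighbour ℓx = punchIn-injective ℓ _ p (proj₂ leaf _ ℓx)

  retract : Fin (suc n) → Fin n
  retract s with ℓ ≟ s
  ... | yes _  = p
  ... | no ℓ≢s = punchOut ℓ≢s

  retract-pivot : retract ℓ ≡ p
  retract-pivot with ℓ ≟ ℓ
  ... | yes _  = refl
  ... | no ℓ≢ℓ = contradiction refl ℓ≢ℓ

  retract-punchIn : ∀ u → retract (punchIn ℓ u) ≡ u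
  retract-punchIn u with ℓ ≟ punchIn ℓ u
  ... | yes ℓ≡ = contradiction (sym ℓ≡) (punchInᵢ≢i ℓ u)
  ... | no  ℓ≢ = trans (punchOut-cong ℓ refl) (punchOut-punchIn ℓ)

  retract-reach : ∀ {s t} → Reach G s t → Reach G′ (retract s) (retract t)
  retract-reach here = here
  retract-reach {s} (step {w = x} sx r) with punchView ℓ s | punchView ℓ x
  ... | pivot      | pivot      = contradiction (trans (sym sx) (irrefl G ℓ)) λ ()
  ... | pivot      | punched x′ = subst (λ z → Reach G′ z _)
    (trans (retract-punchIn x′) (trans (leaf-neighbour sx) (sym retract-pivot))) (retract-reach r)
  ... | punched s′ | pivot      = subst (λ z → Reach G′ z _)
    (trans retract-pivot
      (trans (sym (leaf-neighbour (trans (symm G ℓ _) sx))) (sym (retract-punchIn s′))))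
    (retract-reach r)
  ... | punched s′ | punched x′ = subst (λ z → Reach G′ z _) (sym (retract-punchIn s′))
    (step sx (subst (λ z → Reach G′ z _) (retract-punchIn x′) (retract-reach r)))

  removeLeaf-connected : Connected G → Connected G′
  removeLeaf-connected connected u w =
    subst₂ (Reach G′) (retract-punchIn u) (retract-punchIn w)
      (retract-reach (connected (punchIn ℓ u) (punchIn ℓ w)))

removeVertex-acyclic : ∀ {n} {G : Graph (suc n)} ℓ → Acyclic G → Acyclic (removeVertex G ℓ)
removeVertex-acyclic {G = G} ℓ acyclic (v₀ ∷ v₁ ∷ v₂ ∷ vs) cycle =
  acyclic _ (Equivalence.from IsCycle⇔
    ( UniqueP.map⁺ (punchIn-injective ℓ _ _) u
    , chain-map (punchIn ℓ) (λ _ _ e → e) c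
    , subst (λ z → adj G z (punchIn ℓ v₀) ≡ true) (sym (lastOr-map (punchIn ℓ) v₂ vs)) a))
  where
  open Equivalence (IsCycle⇔ {G = removeVertex G ℓ}) using (to)
  u = proj₁ (to cycle)
  c = proj₁ (proj₂ (to cycle))
  a = proj₂ (proj₂ (to cycle))

removeLeaf-tree : ∀ {n} {G : Graph (suc n)} {ℓ p} → IsLeaf G ℓ (punchIn ℓ p) →
                  IsTree G → IsTree (removeVertex G ℓ)
removeLeaf-tree {ℓ = ℓ} leaf (connected , acyclic) =
  removeLeaf-connected leaf connected , removeVertex-acyclic ℓ acyclic

count-∷ : ∀ {A : Set} (x : A) xs p → count (x ∷ xs) p ≡ (if p x then 1 else 0) ℕ.+ count xs p
count-∷ x xs p with p x
... | true  = refl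
... | false = refl

count-tabulate : ∀ {A : Set} {n} (g : Fin n → A) p →
                 count (tabulate g) p ≡ ℕΣ.sum (λ i → if p (g i) then 1 else 0)
count-tabulate {n = zero}  g p = refl
count-tabulate {n = suc n} g p =
  trans (count-∷ (g zero) (tabulate (g ∘ suc)) p) (cong (_ ℕ.+_) (count-tabulate (g ∘ suc) p))

count-remove : ∀ {n} (p : Fin (suc n) → Bool) ℓ →
               count (allFin (suc n)) p ≡ (if p ℓ then 1 else 0) ℕ.+ count (allFin n) (p ∘ punchIn ℓ)
count-remove p ℓ = trans (count-tabulate id p)
  (trans (ℕΣ.sum-remove {i = ℓ} (λ i → if p i then 1 else 0))
         (cong (_ ℕ.+_) (sym (count-tabulate id (p ∘ punchIn ℓ)))))

+-if : ∀ b → + (if b then 1 else 0) ≡ (if b then 1ℤ else 0ℤ)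
+-if true  = refl
+-if false = refl

+-count : ∀ {n} (p : Fin n → Bool) → + count (allFin n) p ≡ ∑[ i < n ] (if p i then 1ℤ else 0ℤ)
+-count p = trans (cong +_ (count-tabulate id p)) (cast p)
  where
  cast : ∀ {n} (b : Fin n → Bool) →
         + ℕΣ.sum (λ i → if b i then 1 else 0) ≡ ∑[ i < n ] (if b i then 1ℤ else 0ℤ)
  cast {zero}  b = refl
  cast {suc n} b =
    trans (ℤP.pos-+ (if b zero then 1 else 0) _) (cong₂ _+_ (+-if (b zero)) (cast (b ∘ suc)))

degree-removeVertex : ∀ {n} (G : Graph (suc n)) ℓ u →
  degree G (punchIn ℓ u) ≡ (if adj G (punchIn ℓ u) ℓ then 1 else 0) ℕ.+ degree (removeVertex G ℓ) u
degree-removeVertex G ℓ u = count-remove (adj G (punchIn ℓ u)) ℓ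

degree≤ : ∀ {N} (G : Graph (suc N)) v → degree G v ℕ.≤ N
degree≤ {N} G v rewrite count-remove (adj G v) v | irrefl G v =
  ℕP.≤-trans (length-filter _ (allFin N)) (ℕP.≤-reflexive (length-tabulate id))

leaf-degree : ∀ {n} {G : Graph (suc n)} {ℓ p} → IsLeaf G ℓ (punchIn ℓ p) → ∀ u →
  degree G (punchIn ℓ u) ≡ (if does (p ≟ u) then 1 else 0) ℕ.+ degree (removeVertex G ℓ) u
leaf-degree {G = G} {ℓ} {p} leaf u =
  trans (degree-removeVertex G ℓ u) (cong (λ b → (if b then 1 else 0) ℕ.+ _) adjacent)
  where
  adjacent : adj G (punchIn ℓ u) ℓ ≡ does (p ≟ u)
  adjacent with p ≟ u
  ... | yes refl = trans (symm G _ ℓ) (proj₁ leaf)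
  ... | no  p≢u  = 𝔹.¬-not λ uℓ →
    p≢u (sym (leaf-neighbour {G = G} {p = p} leaf {u} (trans (symm G ℓ (punchIn ℓ u)) uℓ)))

-- Colourings in which a single given vertex has colour zero

isZero : ∀ {a} → Fin (suc a) → ℤ
isZero zero    = 1ℤ
isZero (suc _) = 0ℤ

nonZero : ∀ {a} → Fin (suc a) → ℤ
nonZero zero    = 0ℤ
nonZero (suc _) = 1ℤ

zeroOnlyAt : ∀ {n a} → Fin n → Fin n → Fin (suc a) → ℤ
zeroOnlyAt v u c = if does (u ≟ v) then isZero c else nonZero c

colouringsZeroOnlyAt : ∀ {n} → Graph n → ℕ → Fin n → ℤ
colouringsZeroOnlyAt {n} G a v = Σℤ (allFuns n (suc a)) λ κ →
  if proper G κ then product (λ u → zeroOnlyAt v u (κ u)) else 0ℤ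

Σ-allFuns-suc : ∀ {n k} F →
  Σℤ (allFuns (suc n) k) F ≡ ∑[ c < k ] Σℤ (allFuns n k) (λ κ → F (consF c κ))
Σ-allFuns-suc {n} {k} F = begin
  Σℤ (concatMap (λ c → map (consF c) (allFuns n k)) (allFin k)) F
    ≡⟨ Σℤ-concatMap (λ c → map (consF c) (allFuns n k)) (allFin k) F ⟩
  Σℤ (allFin k) (λ c → Σℤ (map (consF c) (allFuns n k)) F)
    ≡⟨ Σℤ-cong (allFin k) (λ c → Σℤ-map (consF c) (allFuns n k) F) ⟩
  Σℤ (allFin k) (λ c → Σℤ (allFuns n k) (λ κ → F (consF c κ)))
    ≡⟨ Σℤ-tabulate id (λ c → Σℤ (allFuns n k) (λ κ → F (consF c κ))) ⟩
  ∑[ c < k ] Σℤ (allFuns n k) (λ κ → F (consF c κ)) ∎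

Σ-allFuns-insert : ∀ {n k} ℓ F →
  Σℤ (allFuns (suc n) k) F ≡ ∑[ c < k ] Σℤ (allFuns n k) (λ κ → F (insert ℓ c κ))
Σ-allFuns-insert                 zero    F = Σ-allFuns-suc F
Σ-allFuns-insert {suc n} {k}     (suc ℓ) F = begin
  Σℤ (allFuns (suc (suc n)) k) F
    ≡⟨ Σ-allFuns-suc F ⟩
  ∑[ c₀ < k ] Σℤ (allFuns (suc n) k) (λ κ → F (consF c₀ κ))
    ≡⟨ sum-cong-≗ {k} (λ c₀ → Σ-allFuns-insert ℓ (λ κ → F (consF c₀ κ))) ⟩
  ∑[ c₀ < k ] ∑[ c < k ] Σℤ (allFuns n k) (λ κ → F (consF c₀ (insert ℓ c κ)))
    ≡⟨ ∑-comm {k} {k} (λ c₀ c → Σℤ (allFuns n k) (λ κ → F (consF c₀ (insert ℓ c κ)))) ⟩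
  ∑[ c < k ] ∑[ c₀ < k ] Σℤ (allFuns n k) (λ κ → F (consF c₀ (insert ℓ c κ)))
    ≡⟨ sum-cong-≗ {k} (λ c → Σ-allFuns-suc (λ κ → F (insert (suc ℓ) c κ))) ⟨
  ∑[ c < k ] Σℤ (allFuns (suc n) k) (λ κ → F (insert (suc ℓ) c κ)) ∎

freeColours : ∀ {a} → Fin (suc a) → ℤ
freeColours {a} d = ∑[ c < suc a ] (if does (c ≟ d) then 0ℤ else nonZero c)

freeColours-zero : ∀ a → freeColours {a} zero ≡ + a
freeColours-zero a = trans (ℤP.+-identityˡ (∑[ c < a ] 1ℤ)) (sum-ones a)

freeColours-suc : ∀ {a} (d : Fin (suc a)) → freeColours (suc d) ≡ + a
freeColours-suc {a} d = begin
  0ℤ + ∑[ c < suc a ] (if does (c ≟ d) then 0ℤ else 1ℤ)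
    ≡⟨ ℤP.+-identityˡ _ ⟩
  ∑[ c < suc a ] (if does (c ≟ d) then 0ℤ else 1ℤ)
    ≡⟨ sum-remove {i = d} (λ c → if does (c ≟ d) then 0ℤ else 1ℤ) ⟩
  (if does (d ≟ d) then 0ℤ else 1ℤ) + ∑[ c < a ] (if does (punchIn d c ≟ d) then 0ℤ else 1ℤ)
    ≡⟨ cong₂ _+_ (cong (λ b → if b then 0ℤ else 1ℤ) (dec-true (d ≟ d) refl))
                 (sum-cong-≗ {a} λ c → cong (λ b → if b then 0ℤ else 1ℤ)
                                             (dec-false (punchIn d c ≟ d) (punchInᵢ≢i d c))) ⟩
  0ℤ + ∑[ c < a ] 1ℤ
    ≡⟨ trans (ℤP.+-identityˡ (∑[ c < a ] 1ℤ)) (sum-ones a) ⟩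
  + a ∎

free-weight : ∀ {a} b (d : Fin (suc a)) →
  let w = if b then isZero d else nonZero d in
  w * freeColours d ≡ (if b then + a else + a - 1ℤ) * w
free-weight {a}     true  zero    =
  trans (ℤP.*-identityˡ _) (trans (freeColours-zero a) (sym (ℤP.*-identityʳ (+ a))))
free-weight {a}     true  (suc d) = sym (ℤP.*-zeroʳ (+ a))
free-weight {a}     false zero    = sym (ℤP.*-zeroʳ (+ a - 1ℤ))
free-weight {suc a} false (suc d) =
  trans (ℤP.*-identityˡ _) (trans (freeColours-suc d) (sym (ℤP.*-identityʳ (+ a))))

zeroOnlyAt-pivot : ∀ {n a} (ℓ : Fin (suc n)) v (c : Fin (suc a)) →
                   zeroOnlyAt (punchIn ℓ v) ℓ c ≡ nonZero c
zeroOnlyAt-pivot ℓ v c =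
  cong (λ b → if b then isZero c else nonZero c) (dec-false (ℓ ≟ punchIn ℓ v) (punchInᵢ≢i ℓ v ∘ sym))

zeroOnlyAt-punchIn : ∀ {n a} (ℓ : Fin (suc n)) v u (c : Fin (suc a)) →
                     zeroOnlyAt (punchIn ℓ v) (punchIn ℓ u) c ≡ zeroOnlyAt v u c
zeroOnlyAt-punchIn ℓ v u c = cong (λ b → if b then isZero c else nonZero c) (punchIn-≟ ℓ u v)

if-∧-* : ∀ b e x y → (if b ∧ not e then y * x else 0ℤ) ≡ (if b then x else 0ℤ) * (if e then 0ℤ else y)
if-∧-* true  true  x y = sym (ℤP.*-zeroʳ x)
if-∧-* true  false x y = ℤP.*-comm y x
if-∧-* false e     x y = refl

colouringsZeroOnlyAt-leaf : ∀ {n} {G : Graph (suc n)} {ℓ p} → IsLeaf G ℓ (punchIn ℓ p) → ∀ a v →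
  colouringsZeroOnlyAt G a (punchIn ℓ v) ≡
  (if does (p ≟ v) then + a else + a - 1ℤ) * colouringsZeroOnlyAt (removeVertex G ℓ) a v
colouringsZeroOnlyAt-leaf {n} {G} {ℓ} {p} leaf a v = begin
  Σℤ (allFuns (suc n) (suc a)) F
    ≡⟨ Σ-allFuns-insert ℓ F ⟩
  ∑[ c < suc a ] Σℤ κs (λ κ → F (insert ℓ c κ))
    ≡⟨ sum-cong-≗ {suc a} (λ c → Σℤ-cong κs (F-insert c)) ⟩
  ∑[ c < suc a ] Σℤ κs (λ κ → X κ * free c (κ p))
    ≡⟨ Σℤ-∑-comm κs {suc a} (λ κ c → X κ * free c (κ p)) ⟨
  Σℤ κs (λ κ → ∑[ c < suc a ] (X κ * free c (κ p)))
    ≡⟨ Σℤ-cong κs (λ κ → *-distribˡ-sum {suc a} (X κ) (λ c → free c (κ p))) ⟨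
  Σℤ κs (λ κ → X κ * freeColours (κ p))
    ≡⟨ Σℤ-cong κs (λ κ → X-free κ (proper G′ κ)) ⟩
  Σℤ κs (λ κ → factor * X κ)
    ≡⟨ *-distribˡ-Σℤ factor κs X ⟨
  factor * Σℤ κs X ∎
  where
  κs = allFuns n (suc a)
  G′ = removeVertex G ℓ
  factor = if does (p ≟ v) then + a else + a - 1ℤ
  F : (Fin (suc n) → Fin (suc a)) → ℤ
  F κ = if proper G κ then product (λ u → zeroOnlyAt (punchIn ℓ v) u (κ u)) else 0ℤ
  Q : (Fin n → Fin (suc a)) → ℤ
  Q κ = product (λ u → zeroOnlyAt v u (κ u))
  X : (Fin n → Fin (suc a)) → ℤ
  X κ = if proper G′ κ then Q κ else 0ℤ
  free : Fin (suc a) → Fin (suc a) → ℤ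
  free c d = if does (c ≟ d) then 0ℤ else nonZero c

  weights : ∀ c κ → product (λ u → zeroOnlyAt (punchIn ℓ v) u (insert ℓ c κ u)) ≡ nonZero c * Q κ
  weights c κ = trans (Product.sum-remove {i = ℓ} (λ u → zeroOnlyAt (punchIn ℓ v) u (insert ℓ c κ u)))
    (cong₂ _*_ (trans (zeroOnlyAt-pivot ℓ v _) (cong nonZero (insert-pivot ℓ c κ)))
               (Product.sum-cong-≗ {n} λ u →
                  trans (zeroOnlyAt-punchIn ℓ v u _) (cong (zeroOnlyAt v u) (insert-punchIn ℓ c κ u))))

  F-insert : ∀ c κ → F (insert ℓ c κ) ≡ X κ * free c (κ p)
  F-insert c κ =
    trans (cong₂ (λ b x → if b then x else 0ℤ) (proper-insert {G = G} {p = p} leaf c κ) (weights c κ))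
          (if-∧-* (proper G′ κ) (does (c ≟ κ p)) (Q κ) (nonZero c))

  X-free : ∀ κ b → (if b then Q κ else 0ℤ) * freeColours (κ p) ≡ factor * (if b then Q κ else 0ℤ)
  X-free κ false = sym (ℤP.*-zeroʳ factor)
  X-free κ true with product-factor (λ u → zeroOnlyAt v u (κ u)) p
  ... | R , Q≡wR = begin
    Q κ * freeColours (κ p)           ≡⟨ cong (_* freeColours (κ p)) Q≡wR ⟩
    w * R * freeColours (κ p)         ≡⟨ swap w R (freeColours (κ p)) ⟩
    w * freeColours (κ p) * R         ≡⟨ cong (_* R) (free-weight (does (p ≟ v)) (κ p)) ⟩
    factor * w * R                    ≡⟨ ℤP.*-assoc factor w R ⟩
    factor * (w * R)                  ≡⟨ cong (factor *_) Q≡wR ⟨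
    factor * Q κ                      ∎
    where
    w = zeroOnlyAt v p (κ p)
    swap : ∀ x y z → x * y * z ≡ x * z * y
    swap = solve-∀

reach-neighbour : ∀ {n} {G : Graph n} {s t} → Reach G s t → s ≢ t → ∃ λ w → adj G s w ≡ true
reach-neighbour here        s≢t = contradiction refl s≢t
reach-neighbour (step sw _) _   = _ , sw

tree-leaf-avoiding : ∀ {N} {T : Graph (suc (suc N))} → IsTree T → ∀ v → ∃₂ λ ℓ p → IsLeaf T ℓ p × ℓ ≢ v
tree-leaf-avoiding (connected , acyclic) v =
  leaf-avoiding acyclic
    (proj₂ (reach-neighbour (connected v (punchIn v zero)) (punchInᵢ≢i v zero ∘ sym)))

leaf-step : ∀ b {N d} a → d ℕ.≤ N →
  (if b then + a else + a - 1ℤ) * ((+ a) ^ d * (+ a - 1ℤ) ^ (N ∸ d)) ≡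
  (+ a) ^ ((if b then 1 else 0) ℕ.+ d) * (+ a - 1ℤ) ^ (suc N ∸ ((if b then 1 else 0) ℕ.+ d))
leaf-step true          a _   = sym (ℤP.*-assoc (+ a) _ _)
leaf-step false {N} {d} a d≤N rewrite ℕP.+-∸-assoc 1 d≤N =
  rotate (+ a - 1ℤ) ((+ a) ^ d) ((+ a - 1ℤ) ^ (N ∸ d))
  where
  rotate : ∀ x y z → x * (y * z) ≡ y * (x * z)
  rotate = solve-∀

colouringsZeroOnlyAt-tree : ∀ N {T : Graph (suc N)} → IsTree T → ∀ a v →
  colouringsZeroOnlyAt T a v ≡ (+ a) ^ degree T v * (+ a - 1ℤ) ^ (N ∸ degree T v)
colouringsZeroOnlyAt-tree zero {T} _ a zero rewrite ℕP.n≤0⇒n≡0 (degree≤ T zero) = begin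
  colouringsZeroOnlyAt T a zero
    ≡⟨ Σ-allFuns-suc F ⟩
  ∑[ c < suc a ] Σℤ (allFuns 0 (suc a)) (λ κ → F (consF c κ))
    ≡⟨ sum-cong-≗ {suc a} (λ c → trans (ℤP.+-identityʳ _) (coloured c (λ ()))) ⟩
  1ℤ + ∑[ c < a ] 0ℤ
    ≡⟨ cong (_+_ 1ℤ) (sum-replicate-zero a) ⟩
  1ℤ ∎
  where
  F : (Fin 1 → Fin (suc a)) → ℤ
  F κ = if proper T κ then product (λ u → zeroOnlyAt zero u (κ u)) else 0ℤ
  no-edges : ∀ {κ : Fin 1 → Fin (suc a)} → ProperColouring T κ
  no-edges zero zero e = contradiction (trans (sym e) (irrefl T zero)) λ ()
  coloured : ∀ c κ → F (consF c κ) ≡ isZero c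
  coloured c κ = trans
    (cong (λ b → if b then isZero c * 1ℤ else 0ℤ) (proper-complete {G = T} {consF c κ} no-edges))
    (ℤP.*-identityʳ (isZero c))
colouringsZeroOnlyAt-tree (suc N) {T} tree a v with tree-leaf-avoiding tree v
... | ℓ , q , leaf , ℓ≢v with punchView ℓ v | punchView ℓ q
...   | pivot      | _          = contradiction refl ℓ≢v
...   | punched v′ | pivot      = contradiction (trans (sym (proj₁ leaf)) (irrefl T ℓ)) λ ()
...   | punched v′ | punched p  = begin
  colouringsZeroOnlyAt T a (punchIn ℓ v′)
    ≡⟨ colouringsZeroOnlyAt-leaf {G = T} {p = p} leaf a v′ ⟩
  factor * colouringsZeroOnlyAt T′ a v′
    ≡⟨ cong (factor *_) (colouringsZeroOnlyAt-tree N (removeLeaf-tree {G = T} {p = p} leaf tree) a v′) ⟩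
  factor * ((+ a) ^ degree T′ v′ * (+ a - 1ℤ) ^ (N ∸ degree T′ v′))
    ≡⟨ leaf-step (does (p ≟ v′)) a (degree≤ T′ v′) ⟩
  (+ a) ^ d * (+ a - 1ℤ) ^ (suc N ∸ d)
    ≡⟨ cong (λ d → (+ a) ^ d * (+ a - 1ℤ) ^ (suc N ∸ d)) (leaf-degree {G = T} {p = p} leaf v′) ⟨
  (+ a) ^ degree T (punchIn ℓ v′) * (+ a - 1ℤ) ^ (suc N ∸ degree T (punchIn ℓ v′)) ∎
  where
  T′ = removeVertex T ℓ
  factor = if does (p ≟ v′) then + a else + a - 1ℤ
  d = (if does (p ≟ v′) then 1 else 0) ℕ.+ degree T′ v′

-- The coefficient of t in X_G(t, 1, …, 1)

∂Π-tabulate : ∀ {A : Set} {n} (g : Fin n → A) f₀ f₁ →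
  ∂Π (tabulate g) f₀ f₁ ≡ ∑[ v < n ] product (λ u → if does (u ≟ v) then f₁ (g u) else f₀ (g u))
∂Π-tabulate {n = zero}  g f₀ f₁ = refl
∂Π-tabulate {n = suc n} g f₀ f₁ = cong₂ _+_
  (cong (f₁ (g zero) *_) (Πℤ-tabulate (g ∘ suc) f₀))
  (trans (cong (f₀ (g zero) *_) (∂Π-tabulate (g ∘ suc) f₀ f₁)) (*-distribˡ-sum {n} (f₀ (g zero))
    (λ v → product (λ u → if does (u ≟ v) then f₁ (g (suc u)) else f₀ (g (suc u))))))

point : ∀ {a} → ℤ → Fin (suc a) → ℤ
point t zero    = t
point t (suc _) = 1ℤ

jet-point : ∀ {a} (c : Fin (suc a)) → HasJet (λ t → point t c) (nonZero c) (isZero c)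
jet-point zero    = (λ _ → 0ℤ) , expand
  where
  expand : ∀ t → t ≡ 0ℤ + t * 1ℤ + t * t * 0ℤ
  expand = solve-∀
jet-point (suc c) = jet-const 1ℤ

jet-chromSym : ∀ {n} (G : Graph n) a →
  ∃ λ p₀ → HasJet (λ t → chromSym G (suc a) (point t)) p₀ (∑[ v < n ] colouringsZeroOnlyAt G a v)
jet-chromSym {n} G a = Σℤ κs f₀ , subst (HasJet (λ t → Σℤ κs (λ κ → F κ t)) (Σℤ κs f₀)) linear
  (jet-Σℤ {xs = κs} {F = F} {f₀} {f₁} (All.tabulate λ {κ} _ → jet-if (proper G κ)
    (jet-Πℤ {xs = allFin n} {F = λ v t → point t (κ v)} {nonZero ∘ κ} {isZero ∘ κ}
      (All.tabulate λ {v} _ → jet-point (κ v)))))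
  where
  κs = allFuns n (suc a)
  F : (Fin n → Fin (suc a)) → ℤ → ℤ
  F κ t = if proper G κ then Πℤ (allFin n) (λ v → point t (κ v)) else 0ℤ
  f₀ f₁ : (Fin n → Fin (suc a)) → ℤ
  f₀ κ = if proper G κ then Πℤ (allFin n) (nonZero ∘ κ) else 0ℤ
  f₁ κ = if proper G κ then ∂Π (allFin n) (nonZero ∘ κ) (isZero ∘ κ) else 0ℤ
  Q : (Fin n → Fin (suc a)) → Fin n → ℤ
  Q κ v = product (λ u → zeroOnlyAt v u (κ u))
  linear : Σℤ κs f₁ ≡ ∑[ v < n ] colouringsZeroOnlyAt G a v
  linear = begin
    Σℤ κs f₁
      ≡⟨ Σℤ-cong κs (λ κ → cong (λ x → if proper G κ then x else 0ℤ)
                                 (∂Π-tabulate id (nonZero ∘ κ) (isZero ∘ κ))) ⟩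
    Σℤ κs (λ κ → if proper G κ then ∑[ v < n ] Q κ v else 0ℤ)
      ≡⟨ Σℤ-cong κs (λ κ → if-∑ (proper G κ) (Q κ)) ⟩
    Σℤ κs (λ κ → ∑[ v < n ] (if proper G κ then Q κ v else 0ℤ))
      ≡⟨ Σℤ-∑-comm κs (λ κ v → if proper G κ then Q κ v else 0ℤ) ⟩
    ∑[ v < n ] colouringsZeroOnlyAt G a v ∎

isOne : ℕ → ℤ
isOne r = if r ≡ᵇ 1 then 1ℤ else 0ℤ

jet-^+ : ∀ c {r} → 1 ℕ.≤ r → HasJet (λ t → t ^ r + c) c (isOne r)
jet-^+ c {suc zero}    _ = (λ _ → 0ℤ) , λ t → expand t c
  where
  expand : ∀ t c → t * 1ℤ + c ≡ c + t * 1ℤ + t * t * 0ℤ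
  expand = solve-∀
jet-^+ c {suc (suc r)} _ = (λ t → t ^ r) , λ t → expand t c (t ^ r)
  where
  expand : ∀ t c x → t * (t * x) + c ≡ c + t * 0ℤ + t * t * x
  expand = solve-∀

Σ-point-^ : ∀ a t r → Σℤ (allFin (suc a)) (λ j → point t j ^ r) ≡ t ^ r + + a
Σ-point-^ a t r = cong (_+_ (t ^ r)) (trans (Σℤ-tabulate {n = a} suc (λ j → point t j ^ r))
  (trans (sum-cong-≗ {a} (λ _ → ℤP.^-zeroˡ r)) (sum-ones a)))

jet-powerSum : ∀ a {λs} → All (1 ℕ.≤_) λs →
  HasJet (λ t → powerSum λs (suc a) (point t)) (Πℤ λs (λ _ → + a)) (∂Π λs (λ _ → + a) isOne)
jet-powerSum a positive =
  jet-Πℤ {F = λ r t → Σℤ (allFin (suc a)) (λ j → point t j ^ r)} {λ _ → + a} {isOne}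
    (All.map (λ {r} 1≤r → jet-cong {p₀ = + a} (λ t → sym (Σ-point-^ a t r)) (jet-^+ (+ a) 1≤r)) positive)

+-m₁-∷ : ∀ r rest → + m₁ (r ∷ rest) ≡ isOne r + + m₁ rest
+-m₁-∷ r rest = trans (cong +_ (count-∷ r rest (_≡ᵇ 1)))
  (trans (ℤP.pos-+ _ (m₁ rest)) (cong (_+ + m₁ rest) (+-if (r ≡ᵇ 1))))

*-∂Π-isOne : ∀ x rest → x * ∂Π rest (λ _ → x) isOne ≡ + m₁ rest * x ^ length rest
*-∂Π-isOne x []         = ℤP.*-zeroʳ x
*-∂Π-isOne x (r ∷ rest) = begin
  x * (isOne r * Πℤ rest (λ _ → x) + x * ∂Π rest (λ _ → x) isOne)
    ≡⟨ cong₂ (λ P D → x * (isOne r * P + D)) (Πℤ-const x rest) (*-∂Π-isOne x rest) ⟩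
  x * (isOne r * x ^ length rest + + m₁ rest * x ^ length rest)
    ≡⟨ collect x (isOne r) (+ m₁ rest) (x ^ length rest) ⟩
  (isOne r + + m₁ rest) * (x * x ^ length rest)
    ≡⟨ cong (_* (x * x ^ length rest)) (+-m₁-∷ r rest) ⟨
  + m₁ (r ∷ rest) * x ^ length (r ∷ rest) ∎
  where
  collect : ∀ x i m p → x * (i * p + m * p) ≡ (i + m) * (x * p)
  collect = solve-∀

∂Π-isOne : ∀ x λs → ∂Π λs (λ _ → x) isOne ≡ + m₁ λs * x ^ (length λs ∸ 1)
∂Π-isOne x []         = refl
∂Π-isOne x (r ∷ rest) = begin
  isOne r * Πℤ rest (λ _ → x) + x * ∂Π rest (λ _ → x) isOne
    ≡⟨ cong₂ (λ P D → isOne r * P + D) (Πℤ-const x rest) (*-∂Π-isOne x rest) ⟩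
  isOne r * x ^ length rest + + m₁ rest * x ^ length rest
    ≡⟨ ℤP.*-distribʳ-+ (x ^ length rest) (isOne r) (+ m₁ rest) ⟨
  (isOne r + + m₁ rest) * x ^ length rest
    ≡⟨ cong (_* x ^ length rest) (+-m₁-∷ r rest) ⟨
  + m₁ (r ∷ rest) * x ^ length rest ∎

partsB-positive : ∀ f m b → All (λ λs → All (1 ℕ.≤_) λs × length λs ℕ.≤ f) (partsB f m b)
partsB-positive f       zero    b = ([] , z≤n) ∷ []
partsB-positive zero    (suc m) b = []
partsB-positive (suc f) (suc m) b = concat⁺ (map⁺ (applyUpTo⁺₂ _ (b ⊓ suc m) λ j → map⁺
  (All.map (λ (positive , short) → (s≤s z≤n ∷ positive) , s≤s short)
           (partsB-positive f (m ∸ j) (suc j)))))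

partsB-nonempty : ∀ f m b → All (λ λs → 1 ℕ.≤ length λs) (partsB f (suc m) b)
partsB-nonempty zero    m b = []
partsB-nonempty (suc f) m b = concat⁺ (map⁺ (applyUpTo⁺₂ _ (b ⊓ suc m) λ j →
  map⁺ (All.universal (λ _ → s≤s z≤n) (partsB f (m ∸ j) (suc j)))))

partitions-positive : ∀ n → All (All (1 ℕ.≤_)) (partitions n)
partitions-positive n = All.map proj₁ (partsB-positive n n n)

partitions-length : ∀ N → All (λ λs → 1 ℕ.≤ length λs × length λs ℕ.≤ suc N) (partitions (suc N))
partitions-length N =
  All.zip (partsB-nonempty (suc N) N (suc N) , All.map proj₂ (partsB-positive (suc N) (suc N) (suc N)))

∑-colouringsZeroOnlyAt-powerSum : ∀ {n} {G : Graph n} {c} → IsPowerSumExpansion G c → ∀ a →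
  ∑[ v < n ] colouringsZeroOnlyAt G a v ≡
  Σℤ (partitions n) (λ λs → c λs * (+ m₁ λs * (+ a) ^ (length λs ∸ 1)))
∑-colouringsZeroOnlyAt-powerSum {n} {G} {c} expansion a =
  jet-unique {p₀ = proj₁ (jet-chromSym G a)} {q₀ = Σℤ (partitions n) f₀} (proj₂ (jet-chromSym G a))
    (jet-cong {p₀ = Σℤ (partitions n) f₀} (λ t → sym (expansion (suc a) (point t))) power-sum-jet)
  where
  F : List ℕ → ℤ → ℤ
  F λs t = c λs * powerSum λs (suc a) (point t)
  f₀ : List ℕ → ℤ
  f₀ λs = c λs * Πℤ λs (λ _ → + a)
  power-sum-jet : HasJet (λ t → Σℤ (partitions n) (λ λs → F λs t)) (Σℤ (partitions n) f₀)
                         (Σℤ (partitions n) (λ λs → c λs * (+ m₁ λs * (+ a) ^ (length λs ∸ 1))))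
  power-sum-jet = subst (HasJet (λ t → Σℤ (partitions n) (λ λs → F λs t)) (Σℤ (partitions n) f₀))
    (Σℤ-cong (partitions n) λ λs → cong (c λs *_) (∂Π-isOne (+ a) λs))
    (jet-Σℤ {F = F} {f₀} {λ λs → c λs * ∂Π λs (λ _ → + a) isOne}
      (All.map (λ {λs} positive → jet-*ˡ (c λs) (jet-powerSum a positive)) (partitions-positive n)))

∑-colouringsZeroOnlyAt-tree : ∀ N {T : Graph (suc N)} → IsTree T → ∀ a →
  ∑[ v < suc N ] colouringsZeroOnlyAt T a v ≡ basisSum N (λ i → + numDeg T i) (+ a)
∑-colouringsZeroOnlyAt-tree N {T} tree a = begin
  ∑[ v < suc N ] colouringsZeroOnlyAt T a v
    ≡⟨ sum-cong-≗ {suc N} (colouringsZeroOnlyAt-tree N tree a) ⟩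
  ∑[ v < suc N ] ((+ a) ^ degree T v * (+ a - 1ℤ) ^ (N ∸ degree T v))
    ≡⟨ sum-cong-≗ {suc N} (λ v → basisSum-indicator N (+ a) (degree≤ T v)) ⟨
  ∑[ v < suc N ] basisSum N (δ v) (+ a)
    ≡⟨ basisSum-∑ N δ (+ a) ⟨
  basisSum N (λ i → ∑[ v < suc N ] δ v i) (+ a)
    ≡⟨ basisSum-cong N (+ a) (λ {i} _ → +-count (λ v → degree T v ≡ᵇ i)) ⟨
  basisSum N (λ i → + numDeg T i) (+ a) ∎
  where
  δ : Fin (suc N) → ℕ → ℤ
  δ v i = if degree T v ≡ᵇ i then 1ℤ else 0ℤ

Σ-m₁-in-basis : ∀ N (c : List ℕ → ℤ) a →
  Σℤ (partitions (suc N)) (λ λs → c λs * (+ m₁ λs * a ^ (length λs ∸ 1))) ≡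
  basisSum N (λ i → Σℤ (partitions (suc N)) (λ λs → c λs * summand (suc N) i λs)) a
Σ-m₁-in-basis N c a = sym (trans
  (basisSum-Σℤ N (partitions (suc N)) (λ λs i → c λs * summand (suc N) i λs) a)
  (Σℤ-congᴬ (partitions-length N) term))
  where
  term : ∀ {λs} → 1 ℕ.≤ length λs × length λs ℕ.≤ suc N →
         basisSum N (λ i → c λs * summand (suc N) i λs) a ≡ c λs * (+ m₁ λs * a ^ (length λs ∸ 1))
  term {r ∷ rest} (_ , s≤s ℓ≤N) = begin
    basisSum N (λ i → c λs * summand (suc N) i λs) a
      ≡⟨ basisSum-cong N a in-basis ⟩
    basisSum N (λ i → c λs * + m₁ λs * basisCoefficient N (length rest) i) a
      ≡⟨ basisSum-*ˡ N (c λs * + m₁ λs) (basisCoefficient N (length rest)) a ⟩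
    c λs * + m₁ λs * basisSum N (basisCoefficient N (length rest)) a
      ≡⟨ cong (c λs * + m₁ λs *_) (basisSum-pow N a ℓ≤N) ⟩
    c λs * + m₁ λs * a ^ length rest
      ≡⟨ ℤP.*-assoc (c λs) (+ m₁ λs) (a ^ length rest) ⟩
    c λs * (+ m₁ λs * a ^ length rest) ∎
    where
    λs = r ∷ rest
    rearrange : ∀ c s m b → c * (s * m * b) ≡ c * m * (s * b)
    rearrange = solve-∀
    in-basis : ∀ {i} → i ℕ.≤ N →
               c λs * summand (suc N) i λs ≡ c λs * + m₁ λs * basisCoefficient N (length rest) i
    in-basis {i} i≤N rewrite Equivalence.to 𝔹.T-≡ (ℕP.<⇒<ᵇ (s≤s i≤N)) | ℕP.+-∸-assoc 1 i≤N =
      rearrange (c λs) (-1ℤ ^ (N ∸ i)) (+ m₁ λs) (+ ((N ∸ length rest) C (N ∸ i)))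

numDeg-beyond : ∀ {N} (T : Graph (suc N)) {b} → ¬ b ℕ.≤ N → + numDeg T b ≡ 0ℤ
numDeg-beyond {N} T {b} b≰N =
  trans (+-count (λ v → degree T v ≡ᵇ b)) (trans (sum-cong-≗ {suc N} none) (sum-replicate-zero (suc N)))
  where
  none : ∀ v → (if degree T v ≡ᵇ b then 1ℤ else 0ℤ) ≡ 0ℤ
  none v = cong (λ x → if x then 1ℤ else 0ℤ) (𝔹.¬-not λ d≡b →
    b≰N (subst (ℕ._≤ N) (ℕP.≡ᵇ⇒≡ _ _ (Equivalence.from 𝔹.T-≡ d≡b)) (degree≤ T v)))

summand-beyond : ∀ {N b} → ¬ b ℕ.≤ N → ∀ λs → summand (suc N) b λs ≡ 0ℤ
summand-beyond {N} {b} b≰N λs = cong (λ x → if x then term else 0ℤ) (𝔹.¬-not λ b<n →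
  b≰N (ℕP.≤-pred (ℕP.<ᵇ⇒< b (suc N) (Equivalence.from 𝔹.T-≡ b<n))))
  where
  term = -1ℤ ^ (suc N ∸ b ∸ 1) * + m₁ λs * + ((suc N ∸ length λs) C (suc N ∸ b ∸ 1))

corollary3p3 : (n : ℕ) (T : Graph n) → IsTree T → (c : List ℕ → ℤ) →
    IsPowerSumExpansion T c → (b : ℕ) →
    + numDeg T b ≡ Σℤ (partitions n) (λ λs → c λs * summand n b λs)
corollary3p3 zero    T _    c _         b = sym (trans (ℤP.+-identityʳ _) (ℤP.*-zeroʳ (c [])))
corollary3p3 (suc N) T tree c expansion b with b ℕ.≤? N
... | yes b≤N = basisSum-injective N {U} {W} agree b≤N
  where
  U W : ℕ → ℤ
  U i = + numDeg T i
  W i = Σℤ (partitions (suc N)) (λ λs → c λs * summand (suc N) i λs)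
  agree : ∀ m → basisSum N U (+ suc m) ≡ basisSum N W (+ suc m)
  agree m = begin
    basisSum N U (+ suc m)                       ≡⟨ ∑-colouringsZeroOnlyAt-tree N tree (suc m) ⟨
    ∑[ v < suc N ] colouringsZeroOnlyAt T (suc m) v
      ≡⟨ ∑-colouringsZeroOnlyAt-powerSum {G = T} {c} expansion (suc m) ⟩
    Σℤ (partitions (suc N)) (λ λs → c λs * (+ m₁ λs * (+ suc m) ^ (length λs ∸ 1)))
      ≡⟨ Σ-m₁-in-basis N c (+ suc m) ⟩
    basisSum N W (+ suc m)                       ∎
... | no  b≰N = trans (numDeg-beyond T b≰N) (sym (Σℤ-zero (partitions (suc N)) λ λs →
  trans (cong (c λs *_) (summand-beyond b≰N λs)) (ℤP.*-zeroʳ (c λs))))
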